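{- Let $n$ and $m$ be positive integers, let $k$ be an integer, and let $L(x_1,\ldots,x_n)$ be a symmetric polynomial with coefficients in a commutative ring $R$. Define $$H'_m(x)=\prod_{1\leqslant i<j\leqslant n}(x_i-x_j)^{2m}\,L(x_1,\ldots,x_n),\qquad H_m(x)=\prod_{1\leqslant i<j\leqslant n}(x_i-x_j)^{2m-1}\,L(x_1,\ldots,x_n).$$ Then $$[x_1^{k-1}\cdots x_n^{k-1}]\,H'_m(x)=n!\,[x_1^{k-n}x_2^{k-n+1}\cdots x_n^{k-1}]\,H_m(x).$$
   Context: $[x_1^{j_1}\cdots x_n^{j_n}]P$ denotes the coefficient of the monomial $x_1^{j_1}\cdots x_n^{j_n}$ in the polynomial $P$ (taken to be $0$ if some exponent is negative). In the monomial on the right, $x_l$ has exponent $k-n+l-1$... more precisely $x_l$ has exponent $k-n+l-1+1 = k-n+l$ for $l=1,\ldots,n$ minus one, i.e. the exponents are $k-n, k-n+1,\ldots,k-1$ for $x_1,x_2,\ldots,x_n$ respectively. -}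

module Defs where

open import Level using (Level)
open import Algebra.Bundles using (CommutativeRing)
open import Data.Nat as ℕ using (ℕ; zero; suc)
open import Data.Integer as ℤ using (ℤ)
open import Data.Fin as Fin using (Fin; toℕ)
open import Data.Fin.Permutation using (Permutation′; _⟨$⟩ʳ_)
open import Data.Vec as Vec using (Vec; []; _∷_)
import Data.Vec.Properties as VecP
open import Data.List as List using (List; []; _∷_; _++_)
open import Data.Maybe using (Maybe; just; nothing)
open import Data.Product using (_×_; _,_)
open import Relation.Nullary using (yes; no)

-- Multivariate polynomials in n variables x₁,…,xₙ (index i : Fin n is x_{i+1})
-- over a commutative ring R, represented as formal finite sums of terms
-- c·x^e (c ∈ R, e ∈ ℕⁿ). Coefficient extraction sums the coefficients of all
-- terms with a given exponent vector, so it is invariant under the choice of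
-- representation; all statements are made via coefficients.
module Poly {c ℓ} (R : CommutativeRing c ℓ) where
  open CommutativeRing R

  Mono : ℕ → Set
  Mono n = Vec ℕ n

  Pol : ℕ → Set c
  Pol n = List (Carrier × Mono n)

  coeff : ∀ {n} → Pol n → Mono n → Carrier
  coeff [] e = 0#
  coeff ((a , f) ∷ p) e with VecP.≡-dec ℕ._≟_ f e
  ... | yes _ = a + coeff p e
  ... | no _  = coeff p e

  -- coefficient at an integer exponent vector (0 if some exponent is negative)
  toℕs : ∀ {n} → Vec ℤ n → Maybe (Mono n)
  toℕs [] = just []
  toℕs (ℤ.+ a ∷ v) with toℕs v
  ... | just w  = just (a ∷ w)
  ... | nothing = nothing
  toℕs (ℤ.-[1+ _ ] ∷ v) = nothing

  coeffℤ : ∀ {n} → Pol n → Vec ℤ n → Carrier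
  coeffℤ p v with toℕs v
  ... | just e  = coeff p e
  ... | nothing = 0#

  one : ∀ {n} → Pol n
  one {n} = (1# , Vec.replicate n 0) ∷ []

  _*ₚ_ : ∀ {n} → Pol n → Pol n → Pol n
  p *ₚ q = List.concatMap (λ { (a , e) → List.map (λ { (b , f) → (a * b , Vec.zipWith ℕ._+_ e f) }) q }) p

  _^ₚ_ : ∀ {n} → Pol n → ℕ → Pol n
  p ^ₚ zero = one
  p ^ₚ suc k = p *ₚ (p ^ₚ k)

  unit : ∀ {n} → Fin n → Mono n
  unit i = Vec.updateAt (Vec.replicate _ 0) i (λ _ → 1)

  diff : ∀ {n} → Fin n → Fin n → Pol n
  diff i j = (1# , unit i) ∷ (- 1# , unit j) ∷ []

  prodₚ : ∀ {n} → List (Pol n) → Pol n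
  prodₚ = List.foldr _*ₚ_ one

  pairs : (n : ℕ) → List (Fin n × Fin n)
  pairs n = List.concatMap (λ i → List.map (λ j → (i , j))
              (List.filter (λ j → i Fin.<? j) (List.allFin n))) (List.allFin n)

  vandPow : (n : ℕ) → ℕ → Pol n
  vandPow n a = prodₚ (List.map (λ { (i , j) → diff i j ^ₚ a }) (pairs n))

  permMono : ∀ {n} → Permutation′ n → Mono n → Mono n
  permMono σ e = Vec.tabulate (λ i → Vec.lookup e (σ ⟨$⟩ʳ i))

  Symmetric : ∀ {n} → Pol n → Set ℓ
  Symmetric {n} L = ∀ (σ : Permutation′ n) (e : Mono n) → coeff L (permMono σ e) ≈ coeff L e

  _·_ : ℕ → Carrier → Carrier
  zero · x = 0#
  suc k · x = x + (k · x)

-- Write Δ^(2m) L = Δ · K with K = Δ^(2m-1) L, and t = (k-1,…,k-1).  For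
-- consecutive variables x_a, x_(a+1), K = (x_a - x_(a+1)) · M with M invariant
-- under x_a ↔ x_(a+1): the swap permutes the other factors of Δ^(2m-1) and
-- fixes the even power (x_a - x_(a+1))^(2m-2) and L.  Hence the coefficients
-- of K around x^t vanish when two consecutive exponents collide and change
-- sign under every transposition.  Expanding Δ one row ∏_{j>i} (x_i - x_j) at
-- a time, the terms of a row either collide (and vanish) or are transposes of
-- the leading term, so a row with r factors contributes r + 1 equal terms and
-- [x^t] (Δ K) = n! · [x^(t - δ)] K with the staircase δ = (n-1,…,1,0).
module Submission where

open import Algebra.Bundles using (CommutativeRing)
open import Data.Empty using (⊥-elim)
open import Data.Fin as F using (Fin; zero; suc; toℕ)
open import Data.Fin.Permutation using (transpose; _⟨$⟩ʳ_)
import Data.Fin.Permutation.Components as PC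
open import Data.Fin.Properties as FinP using () renaming (_≟_ to _F≟_)
open import Data.Integer as Z using (ℤ; -[1+_])
import Data.Integer.Properties as ZP
open import Data.Integer.Solver using (module +-*-Solver)
open import Data.List as List using (List; []; _∷_; _++_)
open import Data.List.Membership.Propositional using (_∈_; _∉_)
open import Data.List.Membership.Propositional.Properties
  using (∈-map⁺; ∈-map⁻; ∈-++⁺ˡ; ∈-++⁺ʳ; ∈-++⁻; ∈-allFin; ∈-filter⁺; ∈-filter⁻)
open import Data.List.Membership.Propositional.Properties.WithK using (unique∧set⇒bag)
import Data.List.Properties as LP
open import Data.List.Relation.Binary.BagAndSetEquality using (∼bag⇒↭)
open import Data.List.Relation.Binary.Permutation.Propositional as ↭ using (_↭_)
import Data.List.Relation.Binary.Permutation.Propositional.Properties as ↭P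
open import Data.List.Relation.Unary.All as All using ([]; _∷_)
open import Data.List.Relation.Unary.All.Properties using (All¬⇒¬Any)
open import Data.List.Relation.Unary.AllPairs as AllPairs using (AllPairs) renaming (tail to UniqueTail)
import Data.List.Relation.Unary.AllPairs.Properties as AllPairsP
open import Data.List.Relation.Unary.Any using (here; there)
open import Data.List.Relation.Unary.Linked using (Linked; []; [-]; _∷_) renaming (tail to LinkedTail; map to LinkedMap)
open import Data.List.Relation.Unary.Unique.Propositional using (Unique; []; _∷_)
import Data.List.Relation.Unary.Unique.Propositional.Properties as UniqueP
open import Data.List.Relation.Unary.Unique.Propositional.Properties using (Unique[x∷xs]⇒x∉xs)
open import Data.Maybe using (just; nothing)
open import Data.Nat as N using (ℕ; zero; suc)
import Data.Nat.Properties as NP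
open import Data.Product using (_×_; _,_; proj₁; proj₂; Σ-syntax)
import Data.Product.Properties as ×P
open import Data.Sum using (inj₁; inj₂)
open import Data.Unit using (⊤; tt)
open import Data.Vec using (Vec; []; _∷_; lookup; zipWith; replicate; tabulate; updateAt)
import Data.Vec.Properties as VP
open import Function using (_∘_)
open import Function.Bundles using (mk⇔)
open import Level using (_⊔_)
open import Relation.Binary.PropositionalEquality as P using (_≡_; _≢_)
open import Relation.Nullary using (Dec; yes; no; ¬_; ¬?)
open import Relation.Nullary.Decidable using (dec-true; dec-false)
open import Defs
module ExponentVectors where
  open P using (refl; sym; trans; cong; cong₂)

  vecExt : ∀ {A : Set} {n} (u v : Vec A n) → (∀ i → lookup u i ≡ lookup v i) → u ≡ v
  vecExt []      []      _ = refl
  vecExt (x ∷ u) (y ∷ v) h = cong₂ _∷_ (h zero) (vecExt u v (h ∘ suc))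

  infixl 6 _⊕_
  _⊕_ : ∀ {n} → Vec ℕ n → Vec ℕ n → Vec ℕ n
  _⊕_ = zipWith N._+_

  𝟎 : ∀ {n} → Vec ℕ n
  𝟎 = replicate _ 0

  lookup-⊕ : ∀ {n} (u v : Vec ℕ n) i → lookup (u ⊕ v) i ≡ lookup u i N.+ lookup v i
  lookup-⊕ u v i = VP.lookup-zipWith N._+_ i u v

  ⊕-assoc : ∀ {n} (u v w : Vec ℕ n) → (u ⊕ v) ⊕ w ≡ u ⊕ (v ⊕ w)
  ⊕-assoc = VP.zipWith-assoc NP.+-assoc

  ⊕-comm : ∀ {n} (u v : Vec ℕ n) → u ⊕ v ≡ v ⊕ u
  ⊕-comm = VP.zipWith-comm NP.+-comm

  ⊕-identityʳ : ∀ {n} (u : Vec ℕ n) → u ⊕ 𝟎 ≡ u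
  ⊕-identityʳ = VP.zipWith-identityʳ NP.+-identityʳ

  single : ∀ {n} → Fin n → ℕ → Vec ℕ n
  single i k = updateAt (replicate _ 0) i (λ _ → k)

  lookup-single-same : ∀ {n} (i : Fin n) k → lookup (single i k) i ≡ k
  lookup-single-same i k = VP.lookup∘updateAt i (replicate _ 0)

  lookup-single-other : ∀ {n} (i j : Fin n) k → i ≢ j → lookup (single i k) j ≡ 0
  lookup-single-other i j k i≢j =
    trans (VP.lookup∘updateAt′ j i (i≢j ∘ sym) (replicate _ 0)) (VP.lookup-replicate j 0)

  raise-same : ∀ {n} (y : Vec ℕ n) p k → lookup (y ⊕ single p k) p ≡ lookup y p N.+ k
  raise-same y p k = trans (lookup-⊕ y (single p k) p) (cong (lookup y p N.+_) (lookup-single-same p k))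

  raise-other : ∀ {n} (y : Vec ℕ n) p q k → p ≢ q → lookup (y ⊕ single p k) q ≡ lookup y q
  raise-other y p q k p≢q = begin
    lookup (y ⊕ single p k) q        ≡⟨ lookup-⊕ y (single p k) q ⟩
    lookup y q N.+ lookup (single p k) q ≡⟨ cong (lookup y q N.+_) (lookup-single-other p q k p≢q) ⟩
    lookup y q N.+ 0                  ≡⟨ NP.+-identityʳ _ ⟩
    lookup y q                        ∎
    where open P.≡-Reasoning

  raise-raise : ∀ {n} (y : Vec ℕ n) p k l → (y ⊕ single p k) ⊕ single p l ≡ y ⊕ single p (k N.+ l)
  raise-raise y p k l = vecExt _ _ entry
    where
    entry : ∀ q → lookup ((y ⊕ single p k) ⊕ single p l) q ≡ lookup (y ⊕ single p (k N.+ l)) q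
    entry q with p F≟ q
    ... | yes refl = trans (raise-same (y ⊕ single p k) p l)
                       (trans (cong (N._+ l) (raise-same y p k))
                         (trans (NP.+-assoc (lookup y p) k l) (sym (raise-same y p (k N.+ l)))))
    ... | no p≢q = trans (raise-other (y ⊕ single p k) p q l p≢q)
                     (trans (raise-other y p q k p≢q) (sym (raise-other y p q (k N.+ l) p≢q)))

  raise-zero : ∀ {n} (y : Vec ℕ n) p → y ⊕ single p 0 ≡ y
  raise-zero y p = vecExt _ _ entry
    where
    entry : ∀ q → lookup (y ⊕ single p 0) q ≡ lookup y q
    entry q with p F≟ q
    ... | yes refl = trans (raise-same y p 0) (NP.+-identityʳ _)
    ... | no p≢q = raise-other y p q 0 p≢q

  τ : ∀ {n} → Fin n → Fin n → Fin n → Fin n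
  τ = PC.transpose

  τ-left : ∀ {n} (a b : Fin n) → τ a b a ≡ b
  τ-left a b rewrite dec-true (a F≟ a) refl = refl

  τ-right : ∀ {n} (a b : Fin n) → τ a b b ≡ a
  τ-right a b with b F≟ a
  ... | yes b≡a = b≡a
  ... | no _ rewrite dec-true (b F≟ b) refl = refl

  τ-other : ∀ {n} (a b k : Fin n) → k ≢ a → k ≢ b → τ a b k ≡ k
  τ-other a b k k≢a k≢b rewrite dec-false (k F≟ a) k≢a | dec-false (k F≟ b) k≢b = refl

  data TranspositionCase {n} (a b k : Fin n) : Set where
    atLeft    : k ≡ a → TranspositionCase a b k
    atRight   : k ≢ a → k ≡ b → TranspositionCase a b k
    elsewhere : k ≢ a → k ≢ b → TranspositionCase a b k

  transpositionCase : ∀ {n} (a b k : Fin n) → TranspositionCase a b k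
  transpositionCase a b k with k F≟ a | k F≟ b
  ... | yes k≡a | _       = atLeft k≡a
  ... | no k≢a  | yes k≡b = atRight k≢a k≡b
  ... | no k≢a  | no k≢b  = elsewhere k≢a k≢b

  τ-involutive : ∀ {n} (a b k : Fin n) → τ a b (τ a b k) ≡ k
  τ-involutive a b k with transpositionCase a b k
  ... | atLeft refl       = trans (cong (τ a b) (τ-left a b)) (τ-right a b)
  ... | atRight _ refl    = trans (cong (τ a b) (τ-right a b)) (τ-left a b)
  ... | elsewhere k≢a k≢b = trans (cong (τ a b) (τ-other a b k k≢a k≢b)) (τ-other a b k k≢a k≢b)

  swapExp : ∀ {n} → Fin n → Fin n → Vec ℕ n → Vec ℕ n
  swapExp a b e = tabulate (λ i → lookup e (transpose a b ⟨$⟩ʳ i))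

  lookup-swapExp : ∀ {n} (a b : Fin n) e i → lookup (swapExp a b e) i ≡ lookup e (τ a b i)
  lookup-swapExp a b e i = VP.lookup∘tabulate _ i

  swapExp-involutive : ∀ {n} (a b : Fin n) e → swapExp a b (swapExp a b e) ≡ e
  swapExp-involutive a b e = vecExt _ _ λ i →
    trans (lookup-swapExp a b (swapExp a b e) i)
      (trans (lookup-swapExp a b e (τ a b i)) (cong (lookup e) (τ-involutive a b i)))

  swapExp-injective : ∀ {n} (a b : Fin n) {e f} → swapExp a b e ≡ swapExp a b f → e ≡ f
  swapExp-injective a b {e} {f} eq =
    trans (sym (swapExp-involutive a b e)) (trans (cong (swapExp a b) eq) (swapExp-involutive a b f))

  swapExp-⊕ : ∀ {n} (a b : Fin n) e f → swapExp a b (e ⊕ f) ≡ swapExp a b e ⊕ swapExp a b f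
  swapExp-⊕ a b e f = vecExt _ _ λ i → begin
    lookup (swapExp a b (e ⊕ f)) i                 ≡⟨ lookup-swapExp a b (e ⊕ f) i ⟩
    lookup (e ⊕ f) (τ a b i)                       ≡⟨ lookup-⊕ e f (τ a b i) ⟩
    lookup e (τ a b i) N.+ lookup f (τ a b i)      ≡⟨ cong₂ N._+_ (sym (lookup-swapExp a b e i)) (sym (lookup-swapExp a b f i)) ⟩
    lookup (swapExp a b e) i N.+ lookup (swapExp a b f) i ≡⟨ sym (lookup-⊕ (swapExp a b e) (swapExp a b f) i) ⟩
    lookup (swapExp a b e ⊕ swapExp a b f) i       ∎
    where open P.≡-Reasoning

  swapExp-replicate : ∀ {n} (a b : Fin n) c → swapExp a b (replicate n c) ≡ replicate n c
  swapExp-replicate a b c = vecExt _ _ λ i →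
    trans (lookup-swapExp a b (replicate _ c) i)
      (trans (VP.lookup-replicate (τ a b i) c) (sym (VP.lookup-replicate i c)))

  swapExp-single : ∀ {n} (a b j : Fin n) k → swapExp a b (single j k) ≡ single (τ a b j) k
  swapExp-single a b j k = vecExt _ _ λ i → trans (lookup-swapExp a b (single j k) i) (entry i)
    where
    entry : ∀ i → lookup (single j k) (τ a b i) ≡ lookup (single (τ a b j) k) i
    entry i with j F≟ τ a b i
    ... | yes refl rewrite τ-involutive a b i =
          trans (lookup-single-same (τ a b i) k) (sym (lookup-single-same i k))
    ... | no j≢τi = trans (lookup-single-other j (τ a b i) k j≢τi)
                      (sym (lookup-single-other (τ a b j) i k
                             (λ τj≡i → j≢τi (trans (sym (τ-involutive a b j)) (cong (τ a b) τj≡i)))))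

  swapExp-raise-left : ∀ {n} (a b : Fin n) z → swapExp a b (z ⊕ single a 1) ≡ swapExp a b z ⊕ single b 1
  swapExp-raise-left a b z = trans (swapExp-⊕ a b z (single a 1))
    (cong (swapExp a b z ⊕_) (trans (swapExp-single a b a 1) (cong (λ x → single x 1) (τ-left a b))))

  swapExp-raise-right : ∀ {n} (a b : Fin n) z → swapExp a b (z ⊕ single b 1) ≡ swapExp a b z ⊕ single a 1
  swapExp-raise-right a b z = trans (swapExp-⊕ a b z (single b 1))
    (cong (swapExp a b z ⊕_) (trans (swapExp-single a b b 1) (cong (λ x → single x 1) (τ-right a b))))

  swapExp-fixed : ∀ {n} (a b : Fin n) z → lookup z a ≡ lookup z b → swapExp a b z ≡ z
  swapExp-fixed a b z za≡zb = vecExt _ _ λ q → trans (lookup-swapExp a b z q) (entry q (transpositionCase a b q))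
    where
    entry : ∀ q → TranspositionCase a b q → lookup z (τ a b q) ≡ lookup z q
    entry q (atLeft refl)      rewrite τ-left a b = sym za≡zb
    entry q (atRight _ refl)   rewrite τ-right a b = za≡zb
    entry q (elsewhere q≢a q≢b) rewrite τ-other a b q q≢a q≢b = refl

  swapExp-conjugate : ∀ {n} (i p j : Fin n) → i ≢ p → p ≢ j → i ≢ j →
                      ∀ z → swapExp i j z ≡ swapExp i p (swapExp p j (swapExp i p z))
  swapExp-conjugate i p j i≢p p≢j i≢j z = vecExt _ _ λ q → begin
    lookup (swapExp i j z) q                                  ≡⟨ lookup-swapExp i j z q ⟩
    lookup z (τ i j q)                                        ≡⟨ cong (lookup z) (sym (conjugate q)) ⟩
    lookup z (τ i p (τ p j (τ i p q)))                        ≡⟨ sym (lookup-swapExp i p z _) ⟩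
    lookup (swapExp i p z) (τ p j (τ i p q))                  ≡⟨ sym (lookup-swapExp p j (swapExp i p z) _) ⟩
    lookup (swapExp p j (swapExp i p z)) (τ i p q)            ≡⟨ sym (lookup-swapExp i p (swapExp p j (swapExp i p z)) q) ⟩
    lookup (swapExp i p (swapExp p j (swapExp i p z))) q      ∎
    where
    open P.≡-Reasoning
    conjugate : ∀ q → τ i p (τ p j (τ i p q)) ≡ τ i j q
    conjugate q with transpositionCase i p q
    ... | atLeft refl rewrite τ-left i p | τ-left p j | τ-other i p j (i≢j ∘ sym) (p≢j ∘ sym) | τ-left i j = refl
    ... | atRight q≢i q≡p rewrite q≡p | τ-right i p | τ-other p j i i≢p i≢j | τ-left i p
                                | τ-other i j p (i≢p ∘ sym) p≢j = refl
    ... | elsewhere q≢i q≢p with q F≟ j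
    ...   | yes refl rewrite τ-other i p q q≢i q≢p | τ-right p q | τ-right i p | τ-right i q = refl
    ...   | no q≢j rewrite τ-other i p q q≢i q≢p | τ-other p j q q≢p q≢j | τ-other i p q q≢i q≢p
                         | τ-other i j q q≢i q≢j = refl

  infixl 6 _∸ᵥ_
  _∸ᵥ_ : ∀ {n} → Vec ℕ n → Vec ℕ n → Vec ℕ n
  _∸ᵥ_ = zipWith N._∸_

  infix 4 _≤ᵥ_
  _≤ᵥ_ : ∀ {n} → Vec ℕ n → Vec ℕ n → Set
  u ≤ᵥ v = ∀ i → lookup u i N.≤ lookup v i

  _≤ᵥ?_ : ∀ {n} (u v : Vec ℕ n) → Dec (u ≤ᵥ v)
  u ≤ᵥ? v = FinP.all? (λ i → lookup u i N.≤? lookup v i)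

  lookup-∸ᵥ : ∀ {n} (u v : Vec ℕ n) i → lookup (u ∸ᵥ v) i ≡ lookup u i N.∸ lookup v i
  lookup-∸ᵥ u v i = VP.lookup-zipWith N._∸_ i u v

  ⊕≡⇒≡∸ᵥ : ∀ {n} (y t f : Vec ℕ n) → y ⊕ f ≡ t → f ≡ t ∸ᵥ y
  ⊕≡⇒≡∸ᵥ y t f refl = vecExt _ _ λ i → sym (trans (lookup-∸ᵥ (y ⊕ f) y i)
    (trans (cong (N._∸ lookup y i) (lookup-⊕ y f i)) (NP.m+n∸m≡n (lookup y i) (lookup f i))))

  ≡∸ᵥ⇒⊕≡ : ∀ {n} (y t : Vec ℕ n) → y ≤ᵥ t → y ⊕ (t ∸ᵥ y) ≡ t
  ≡∸ᵥ⇒⊕≡ y t y≤t = vecExt _ _ λ i → trans (lookup-⊕ y (t ∸ᵥ y) i)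
    (trans (cong (lookup y i N.+_) (lookup-∸ᵥ t y i)) (NP.m+[n∸m]≡n (y≤t i)))

  ⊕≡⇒≤ᵥ : ∀ {n} (y t f : Vec ℕ n) → y ⊕ f ≡ t → y ≤ᵥ t
  ⊕≡⇒≤ᵥ y t f refl i = P.subst (lookup y i N.≤_) (sym (lookup-⊕ y f i)) (NP.m≤m+n (lookup y i) (lookup f i))

  intDiff : ∀ {n} → Vec ℕ n → Vec ℕ n → Vec ℤ n
  intDiff = zipWith (λ a b → Z.+ a Z.- Z.+ b)

  negate-pos-∸ : ∀ m n → m N.< n → Z.- (Z.+ (n N.∸ m)) ≡ -[1+ (n N.∸ suc m) ]
  negate-pos-∸ zero    (suc n) _            = refl
  negate-pos-∸ (suc m) (suc n) (N.s≤s m<n) = negate-pos-∸ m n m<n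

  lookup-intDiff-≤ : ∀ {n} (t y : Vec ℕ n) → y ≤ᵥ t → ∀ i → lookup (intDiff t y) i ≡ Z.+ lookup (t ∸ᵥ y) i
  lookup-intDiff-≤ t y y≤t i = trans (VP.lookup-zipWith _ i t y) (trans (ZP.m-n≡m⊖n (lookup t i) (lookup y i))
    (trans (ZP.⊖-≥ (y≤t i)) (cong Z.+_ (sym (lookup-∸ᵥ t y i)))))

  lookup-intDiff-> : ∀ {n} (t y : Vec ℕ n) i → lookup t i N.< lookup y i →
                     lookup (intDiff t y) i ≡ -[1+ (lookup y i N.∸ suc (lookup t i)) ]
  lookup-intDiff-> t y i ti<yi = trans (VP.lookup-zipWith _ i t y) (trans (ZP.m-n≡m⊖n (lookup t i) (lookup y i))
    (trans (ZP.⊖-< ti<yi) (negate-pos-∸ (lookup t i) (lookup y i) ti<yi)))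

-- Everything is expressed through the shifted coefficient
--   shiftedCoeff P t y = [x^t] (x^y · P),
-- which, unlike [x^(t - y)] P, needs no subtraction of exponent vectors and
-- turns products into iterated sums (shiftedCoeff-*).
module PolyAlgebra {c ℓ} (R : CommutativeRing c ℓ) where
  open CommutativeRing R
  open Poly R
  open ExponentVectors
  open import Relation.Binary.Reasoning.Setoid setoid
  open import Algebra.Properties.Ring ring
    using (-‿distribˡ-*; -1*x≈-x; -‿involutive; -0#≈0#; -‿+-comm; ⁻¹-anti-homo‿-)
  open import Algebra.Properties.CommutativeSemigroup *-commutativeSemigroup using (x∙yz≈y∙xz)

  termSum : ∀ {n} → Pol n → (Mono n → Carrier) → Carrier
  termSum []            h = 0#
  termSum ((a , f) ∷ P) h = a * h f + termSum P h

  termSum-cong : ∀ {n} (P : Pol n) {h h′ : Mono n → Carrier} → (∀ f → h f ≈ h′ f) → termSum P h ≈ termSum P h′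
  termSum-cong []            h≈h′ = refl
  termSum-cong ((a , f) ∷ P) h≈h′ = +-cong (*-congˡ (h≈h′ f)) (termSum-cong P h≈h′)

  termSum-++ : ∀ {n} (P Q : Pol n) h → termSum (P ++ Q) h ≈ termSum P h + termSum Q h
  termSum-++ []            Q h = sym (+-identityˡ _)
  termSum-++ ((a , f) ∷ P) Q h = trans (+-congˡ (termSum-++ P Q h)) (sym (+-assoc _ _ _))

  termSum-+ : ∀ {n} (P : Pol n) h h′ → termSum P (λ f → h f + h′ f) ≈ termSum P h + termSum P h′
  termSum-+ []            h h′ = sym (+-identityˡ _)
  termSum-+ ((a , f) ∷ P) h h′ = begin
    a * (h f + h′ f) + termSum P (λ f → h f + h′ f)       ≈⟨ +-cong (distribˡ a _ _) (termSum-+ P h h′) ⟩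
    (a * h f + a * h′ f) + (termSum P h + termSum P h′)   ≈⟨ +-assoc _ _ _ ⟩
    a * h f + (a * h′ f + (termSum P h + termSum P h′))   ≈⟨ +-congˡ (sym (+-assoc _ _ _)) ⟩
    a * h f + ((a * h′ f + termSum P h) + termSum P h′)   ≈⟨ +-congˡ (+-congʳ (+-comm _ _)) ⟩
    a * h f + ((termSum P h + a * h′ f) + termSum P h′)   ≈⟨ +-congˡ (+-assoc _ _ _) ⟩
    a * h f + (termSum P h + (a * h′ f + termSum P h′))   ≈⟨ sym (+-assoc _ _ _) ⟩
    (a * h f + termSum P h) + (a * h′ f + termSum P h′)   ∎

  termSum-scale : ∀ {n} (P : Pol n) b h → termSum P (λ f → b * h f) ≈ b * termSum P h
  termSum-scale []            b h = sym (zeroʳ b)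
  termSum-scale ((a , f) ∷ P) b h = begin
    a * (b * h f) + termSum P (λ f → b * h f) ≈⟨ +-cong (x∙yz≈y∙xz a b (h f)) (termSum-scale P b h) ⟩
    b * (a * h f) + b * termSum P h          ≈⟨ sym (distribˡ b _ _) ⟩
    b * (a * h f + termSum P h)              ∎

  termSum-zero : ∀ {n} (P : Pol n) → termSum P (λ _ → 0#) ≈ 0#
  termSum-zero []            = refl
  termSum-zero ((a , f) ∷ P) = trans (+-cong (zeroʳ a) (termSum-zero P)) (+-identityˡ _)

  termSum-swap : ∀ {n} (P Q : Pol n) (H : Mono n → Mono n → Carrier) →
                 termSum P (λ f → termSum Q (H f)) ≈ termSum Q (λ g → termSum P (λ f → H f g))
  termSum-swap []            Q H = sym (termSum-zero Q)
  termSum-swap ((a , f) ∷ P) Q H = begin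
    a * termSum Q (H f) + termSum P (λ f → termSum Q (H f))          ≈⟨ +-cong (sym (termSum-scale Q a (H f))) (termSum-swap P Q H) ⟩
    termSum Q (λ g → a * H f g) + termSum Q (λ g → termSum P (λ f → H f g)) ≈⟨ sym (termSum-+ Q _ _) ⟩
    termSum Q (λ g → a * H f g + termSum P (λ f → H f g))          ∎

  termSum-* : ∀ {n} (P Q : Pol n) h → termSum (P *ₚ Q) h ≈ termSum P (λ f → termSum Q (λ g → h (f ⊕ g)))
  termSum-* []            Q h = refl
  termSum-* ((a , f) ∷ P) Q h = begin
    termSum (aQ ++ P *ₚ Q) h                ≈⟨ termSum-++ aQ (P *ₚ Q) h ⟩
    termSum aQ h + termSum (P *ₚ Q) h       ≈⟨ +-cong (termSum-monomial Q) (termSum-* P Q h) ⟩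
    a * termSum Q (λ g → h (f ⊕ g)) + termSum P (λ f → termSum Q (λ g → h (f ⊕ g))) ∎
    where
    aQ = List.map (λ { (b , g) → (a * b , zipWith N._+_ f g) }) Q
    termSum-monomial : ∀ Q → termSum (List.map (λ { (b , g) → (a * b , zipWith N._+_ f g) }) Q) h
                             ≈ a * termSum Q (λ g → h (f ⊕ g))
    termSum-monomial []            = sym (zeroʳ a)
    termSum-monomial ((b , g) ∷ Q) =
      trans (+-cong (*-assoc _ _ _) (termSum-monomial Q)) (sym (distribˡ a _ _))

  indicator : ∀ {n} → Mono n → Mono n → Carrier
  indicator u t with VP.≡-dec N._≟_ u t
  ... | yes _ = 1#
  ... | no _  = 0#

  indicator-injective : ∀ {n} (φ : Mono n → Mono n) → (∀ {x y} → φ x ≡ φ y → x ≡ y) →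
                        ∀ u t → indicator u t ≡ indicator (φ u) (φ t)
  indicator-injective φ inj u t with VP.≡-dec N._≟_ u t | VP.≡-dec N._≟_ (φ u) (φ t)
  ... | yes _    | yes _   = P.refl
  ... | no _     | no _    = P.refl
  ... | yes u≡t  | no φu≢φt = ⊥-elim (φu≢φt (P.cong φ u≡t))
  ... | no u≢t   | yes φu≡φt = ⊥-elim (u≢t (inj φu≡φt))

  shiftedCoeff : ∀ {n} → Pol n → Mono n → Mono n → Carrier
  shiftedCoeff P t y = termSum P (λ f → indicator (y ⊕ f) t)

  shiftedCoeff-≡ : ∀ {n} (P : Pol n) t {y y′} → y ≡ y′ → shiftedCoeff P t y ≈ shiftedCoeff P t y′
  shiftedCoeff-≡ P t y≡y′ = reflexive (P.cong (shiftedCoeff P t) y≡y′)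

  infix 4 _≋_
  record _≋_ {n} (P Q : Pol n) : Set ℓ where
    constructor mk≋
    field sameCoeffs : ∀ t y → shiftedCoeff P t y ≈ shiftedCoeff Q t y
  open _≋_ public

  ≋-refl : ∀ {n} {P : Pol n} → P ≋ P
  ≋-refl = mk≋ λ t y → refl

  ≋-reflexive : ∀ {n} {P Q : Pol n} → P ≡ Q → P ≋ Q
  ≋-reflexive P.refl = ≋-refl

  ≋-sym : ∀ {n} {P Q : Pol n} → P ≋ Q → Q ≋ P
  ≋-sym P≋Q = mk≋ λ t y → sym (sameCoeffs P≋Q t y)

  ≋-trans : ∀ {n} {P Q S : Pol n} → P ≋ Q → Q ≋ S → P ≋ S
  ≋-trans P≋Q Q≋S = mk≋ λ t y → trans (sameCoeffs P≋Q t y) (sameCoeffs Q≋S t y)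

  shiftedCoeff-* : ∀ {n} (P Q : Pol n) t y → shiftedCoeff (P *ₚ Q) t y ≈ termSum P (λ f → shiftedCoeff Q t (y ⊕ f))
  shiftedCoeff-* P Q t y = trans (termSum-* P Q _) (termSum-cong P λ f → termSum-cong Q λ g →
    reflexive (P.cong (λ v → indicator v t) (P.sym (⊕-assoc y f g))))

  *-comm≋ : ∀ {n} (P Q : Pol n) → P *ₚ Q ≋ Q *ₚ P
  *-comm≋ P Q = mk≋ λ t y → begin
    shiftedCoeff (P *ₚ Q) t y                                      ≈⟨ termSum-* P Q _ ⟩
    termSum P (λ f → termSum Q (λ g → indicator (y ⊕ (f ⊕ g)) t)) ≈⟨ termSum-swap P Q _ ⟩
    termSum Q (λ g → termSum P (λ f → indicator (y ⊕ (f ⊕ g)) t)) ≈⟨ termSum-cong Q (λ g → termSum-cong P λ f →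
                                                                       reflexive (P.cong (λ v → indicator (y ⊕ v) t) (⊕-comm f g))) ⟩
    termSum Q (λ g → termSum P (λ f → indicator (y ⊕ (g ⊕ f)) t)) ≈⟨ sym (termSum-* Q P _) ⟩
    shiftedCoeff (Q *ₚ P) t y                                      ∎

  *-congˡ≋ : ∀ {n} (P : Pol n) {Q Q′} → Q ≋ Q′ → P *ₚ Q ≋ P *ₚ Q′
  *-congˡ≋ P {Q} {Q′} Q≋Q′ = mk≋ λ t y →
    trans (shiftedCoeff-* P Q t y)
      (trans (termSum-cong P (λ f → sameCoeffs Q≋Q′ t (y ⊕ f))) (sym (shiftedCoeff-* P Q′ t y)))

  *-congʳ≋ : ∀ {n} {P P′} (Q : Pol n) → P ≋ P′ → P *ₚ Q ≋ P′ *ₚ Q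
  *-congʳ≋ {P = P} {P′} Q P≋P′ = ≋-trans (*-comm≋ P Q) (≋-trans (*-congˡ≋ Q P≋P′) (*-comm≋ Q P′))

  *-cong≋ : ∀ {n} {P P′ Q Q′ : Pol n} → P ≋ P′ → Q ≋ Q′ → P *ₚ Q ≋ P′ *ₚ Q′
  *-cong≋ {P′ = P′} {Q = Q} P≋P′ Q≋Q′ = ≋-trans (*-congʳ≋ Q P≋P′) (*-congˡ≋ P′ Q≋Q′)

  *-assoc≋ : ∀ {n} (P Q S : Pol n) → (P *ₚ Q) *ₚ S ≋ P *ₚ (Q *ₚ S)
  *-assoc≋ P Q S = mk≋ λ t y → begin
    shiftedCoeff ((P *ₚ Q) *ₚ S) t y                                   ≈⟨ shiftedCoeff-* (P *ₚ Q) S t y ⟩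
    termSum (P *ₚ Q) (λ e → shiftedCoeff S t (y ⊕ e))                 ≈⟨ termSum-* P Q _ ⟩
    termSum P (λ f → termSum Q (λ g → shiftedCoeff S t (y ⊕ (f ⊕ g)))) ≈⟨ termSum-cong P (λ f → termSum-cong Q λ g →
                                                                           shiftedCoeff-≡ S t (P.sym (⊕-assoc y f g))) ⟩
    termSum P (λ f → termSum Q (λ g → shiftedCoeff S t ((y ⊕ f) ⊕ g))) ≈⟨ termSum-cong P (λ f → sym (shiftedCoeff-* Q S t (y ⊕ f))) ⟩
    termSum P (λ f → shiftedCoeff (Q *ₚ S) t (y ⊕ f))                 ≈⟨ sym (shiftedCoeff-* P (Q *ₚ S) t y) ⟩
    shiftedCoeff (P *ₚ (Q *ₚ S)) t y                                   ∎

  *-leftComm≋ : ∀ {n} (P Q S : Pol n) → P *ₚ (Q *ₚ S) ≋ Q *ₚ (P *ₚ S)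
  *-leftComm≋ P Q S =
    ≋-trans (≋-sym (*-assoc≋ P Q S)) (≋-trans (*-congʳ≋ S (*-comm≋ P Q)) (*-assoc≋ Q P S))

  *-identityˡ≋ : ∀ {n} (Q : Pol n) → one *ₚ Q ≋ Q
  *-identityˡ≋ Q = mk≋ λ t y →
    trans (shiftedCoeff-* one Q t y) (trans (+-identityʳ _) (trans (*-identityˡ _) (shiftedCoeff-≡ Q t (⊕-identityʳ y))))

  termSum-diff : ∀ {n} (a b : Fin n) h → termSum (diff a b) h ≈ h (single a 1) - h (single b 1)
  termSum-diff a b h = +-cong (*-identityˡ _) (trans (+-identityʳ _) (-1*x≈-x _))

  shiftedCoeff-diff* : ∀ {n} (a b : Fin n) Q t y →
    shiftedCoeff (diff a b *ₚ Q) t y ≈ shiftedCoeff Q t (y ⊕ single a 1) - shiftedCoeff Q t (y ⊕ single b 1)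
  shiftedCoeff-diff* a b Q t y =
    trans (shiftedCoeff-* (diff a b) Q t y) (termSum-diff a b (λ f → shiftedCoeff Q t (y ⊕ f)))

  negate : ∀ {n} → Pol n → Pol n
  negate = List.map (λ { (a , f) → (- a , f) })

  termSum-negate : ∀ {n} (P : Pol n) h → termSum (negate P) h ≈ - termSum P h
  termSum-negate []            h = sym -0#≈0#
  termSum-negate ((a , f) ∷ P) h =
    trans (+-cong (sym (-‿distribˡ-* a (h f))) (termSum-negate P h)) (-‿+-comm _ _)

  negate-cong : ∀ {n} {P Q : Pol n} → P ≋ Q → negate P ≋ negate Q
  negate-cong {P = P} {Q} P≋Q = mk≋ λ t y →
    trans (termSum-negate P _) (trans (-‿cong (sameCoeffs P≋Q t y)) (sym (termSum-negate Q _)))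

  negate-involutive : ∀ {n} (P : Pol n) → negate (negate P) ≋ P
  negate-involutive P = mk≋ λ t y →
    trans (termSum-negate (negate P) _) (trans (-‿cong (termSum-negate P _)) (-‿involutive _))

  negate-*ˡ : ∀ {n} (P Q : Pol n) → negate P *ₚ Q ≋ negate (P *ₚ Q)
  negate-*ˡ P Q = mk≋ λ t y → begin
    shiftedCoeff (negate P *ₚ Q) t y                       ≈⟨ shiftedCoeff-* (negate P) Q t y ⟩
    termSum (negate P) (λ f → shiftedCoeff Q t (y ⊕ f))   ≈⟨ termSum-negate P _ ⟩
    - termSum P (λ f → shiftedCoeff Q t (y ⊕ f))          ≈⟨ -‿cong (sym (shiftedCoeff-* P Q t y)) ⟩
    - shiftedCoeff (P *ₚ Q) t y                            ≈⟨ sym (termSum-negate (P *ₚ Q) _) ⟩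
    shiftedCoeff (negate (P *ₚ Q)) t y                     ∎

  negate-*ʳ : ∀ {n} (P Q : Pol n) → P *ₚ negate Q ≋ negate (P *ₚ Q)
  negate-*ʳ P Q = ≋-trans (*-comm≋ P (negate Q)) (≋-trans (negate-*ˡ Q P) (negate-cong (*-comm≋ Q P)))

  diff-antisym : ∀ {n} (a b : Fin n) → diff b a ≋ negate (diff a b)
  diff-antisym a b = mk≋ λ t y → begin
    termSum (diff b a) (h t y)                  ≈⟨ termSum-diff b a (h t y) ⟩
    h t y (single b 1) - h t y (single a 1)     ≈⟨ sym (⁻¹-anti-homo‿- _ _) ⟩
    - (h t y (single a 1) - h t y (single b 1)) ≈⟨ -‿cong (sym (termSum-diff a b (h t y))) ⟩
    - termSum (diff a b) (h t y)                ≈⟨ sym (termSum-negate (diff a b) (h t y)) ⟩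
    termSum (negate (diff a b)) (h t y)         ∎
    where
    h : _ → _ → _ → Carrier
    h t y f = indicator (y ⊕ f) t

  swapVars : ∀ {n} → Fin n → Fin n → Pol n → Pol n
  swapVars a b = List.map (λ { (c , f) → (c , swapExp a b f) })

  termSum-swapVars : ∀ {n} (a b : Fin n) P h → termSum (swapVars a b P) h ≡ termSum P (h ∘ swapExp a b)
  termSum-swapVars a b []            h = P.refl
  termSum-swapVars a b ((c , f) ∷ P) h = P.cong (c * h (swapExp a b f) +_) (termSum-swapVars a b P h)

  shiftedCoeff-swapVars : ∀ {n} (a b : Fin n) P t y →
    shiftedCoeff (swapVars a b P) t y ≈ shiftedCoeff P (swapExp a b t) (swapExp a b y)
  shiftedCoeff-swapVars a b P t y = trans (reflexive (termSum-swapVars a b P _)) (termSum-cong P λ f → reflexive (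
    P.trans (indicator-injective (swapExp a b) (swapExp-injective a b) (y ⊕ swapExp a b f) t)
            (P.cong (λ v → indicator v (swapExp a b t))
              (P.trans (swapExp-⊕ a b y (swapExp a b f)) (P.cong (swapExp a b y ⊕_) (swapExp-involutive a b f))))))

  swapVars-* : ∀ {n} (a b : Fin n) P Q → swapVars a b (P *ₚ Q) ≋ swapVars a b P *ₚ swapVars a b Q
  swapVars-* a b P Q = mk≋ λ t y → begin
    shiftedCoeff (swapVars a b (P *ₚ Q)) t y               ≈⟨ shiftedCoeff-swapVars a b (P *ₚ Q) t y ⟩
    shiftedCoeff (P *ₚ Q) (s t) (s y)                      ≈⟨ shiftedCoeff-* P Q (s t) (s y) ⟩
    termSum P (λ f → shiftedCoeff Q (s t) (s y ⊕ f))       ≈⟨ termSum-cong P (λ f → shiftedCoeff-≡ Q (s t) (swap-shift y f)) ⟩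
    termSum P (λ f → shiftedCoeff Q (s t) (s (y ⊕ s f)))   ≈⟨ termSum-cong P (λ f → sym (shiftedCoeff-swapVars a b Q t (y ⊕ s f))) ⟩
    termSum P (λ f → shiftedCoeff (swapVars a b Q) t (y ⊕ s f)) ≡⟨ P.sym (termSum-swapVars a b P _) ⟩
    termSum (swapVars a b P) (λ f → shiftedCoeff (swapVars a b Q) t (y ⊕ f)) ≈⟨ sym (shiftedCoeff-* (swapVars a b P) (swapVars a b Q) t y) ⟩
    shiftedCoeff (swapVars a b P *ₚ swapVars a b Q) t y    ∎
    where
    s = swapExp a b
    swap-shift : ∀ y f → s y ⊕ f ≡ s (y ⊕ s f)
    swap-shift y f = P.trans (P.cong (s y ⊕_) (P.sym (swapExp-involutive a b f))) (P.sym (swapExp-⊕ a b y (s f)))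

  swapVars-one : ∀ {n} (a b : Fin n) → swapVars a b (one {n}) ≋ one
  swapVars-one a b = mk≋ λ t y →
    +-congʳ (*-congˡ (reflexive (P.cong (λ v → indicator (y ⊕ v) t) (swapExp-replicate a b 0))))

  swapVars-diff : ∀ {n} (a b i j : Fin n) → swapVars a b (diff i j) ≡ diff (τ a b i) (τ a b j)
  swapVars-diff a b i j = P.cong₂ (λ u v → (1# , u) ∷ (- 1# , v) ∷ []) (swapExp-single a b i 1) (swapExp-single a b j 1)

  ^-cong≋ : ∀ {n} {P Q : Pol n} k → P ≋ Q → P ^ₚ k ≋ Q ^ₚ k
  ^-cong≋ zero    P≋Q = ≋-refl
  ^-cong≋ (suc k) P≋Q = *-cong≋ P≋Q (^-cong≋ k P≋Q)

  swapVars-^ : ∀ {n} (a b : Fin n) P k → swapVars a b (P ^ₚ k) ≋ swapVars a b P ^ₚ k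
  swapVars-^ a b P zero    = swapVars-one a b
  swapVars-^ a b P (suc k) = ≋-trans (swapVars-* a b P (P ^ₚ k)) (*-congˡ≋ (swapVars a b P) (swapVars-^ a b P k))

  swapVars-even-^ : ∀ {n} (a b : Fin n) P → swapVars a b P ≋ negate P →
                    ∀ k → swapVars a b (P ^ₚ (k N.+ k)) ≋ P ^ₚ (k N.+ k)
  swapVars-even-^ a b P anti zero    = swapVars-one a b
  swapVars-even-^ a b P anti (suc k) rewrite NP.+-suc k k =
    ≋-trans (swapVars-* a b P (P *ₚ X))
    (≋-trans (*-congˡ≋ (swapVars a b P) (swapVars-* a b P X))
    (≋-trans (*-cong≋ anti (*-cong≋ anti (swapVars-even-^ a b P anti k)))
    (≋-trans (negate-*ˡ P (negate P *ₚ X))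
    (≋-trans (negate-cong (*-congˡ≋ P (negate-*ˡ P X)))
    (≋-trans (negate-cong (negate-*ʳ P (P *ₚ X))) (negate-involutive (P *ₚ (P *ₚ X))))))))
    where X = P ^ₚ (k N.+ k)

  prodₚ-++ : ∀ {n} (xs ys : List (Pol n)) → prodₚ (xs ++ ys) ≋ prodₚ xs *ₚ prodₚ ys
  prodₚ-++ []       ys = ≋-sym (*-identityˡ≋ _)
  prodₚ-++ (x ∷ xs) ys = ≋-trans (*-congˡ≋ x (prodₚ-++ xs ys)) (≋-sym (*-assoc≋ x _ _))

  prodₚ-↭ : ∀ {n} {xs ys : List (Pol n)} → xs ↭ ys → prodₚ xs ≋ prodₚ ys
  prodₚ-↭ ↭.refl          = ≋-refl
  prodₚ-↭ (↭.prep x p)    = *-congˡ≋ x (prodₚ-↭ p)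
  prodₚ-↭ (↭.swap x y p)  = ≋-trans (*-congˡ≋ x (*-congˡ≋ y (prodₚ-↭ p))) (*-leftComm≋ x y _)
  prodₚ-↭ (↭.trans p q)   = ≋-trans (prodₚ-↭ p) (prodₚ-↭ q)

  prodₚ-map-cong : ∀ {n} {A : Set} (f g : A → Pol n) (zs : List A) → (∀ z → f z ≋ g z) →
                   prodₚ (List.map f zs) ≋ prodₚ (List.map g zs)
  prodₚ-map-cong f g []       f≋g = ≋-refl
  prodₚ-map-cong f g (z ∷ zs) f≋g = *-cong≋ (f≋g z) (prodₚ-map-cong f g zs f≋g)

  prodₚ-map-* : ∀ {n} {A : Set} (f g : A → Pol n) (zs : List A) →
    prodₚ (List.map (λ z → f z *ₚ g z) zs) ≋ prodₚ (List.map f zs) *ₚ prodₚ (List.map g zs)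
  prodₚ-map-* f g []       = ≋-sym (*-identityˡ≋ _)
  prodₚ-map-* f g (z ∷ zs) =
    ≋-trans (*-congˡ≋ (f z *ₚ g z) (prodₚ-map-* f g zs))
    (≋-trans (*-assoc≋ (f z) (g z) (F *ₚ G))
    (≋-trans (*-congˡ≋ (f z) (*-leftComm≋ (g z) F G)) (≋-sym (*-assoc≋ (f z) F (g z *ₚ G)))))
    where F = prodₚ (List.map f zs)
          G = prodₚ (List.map g zs)

  swapVars-prodₚ : ∀ {n} (a b : Fin n) (xs : List (Pol n)) →
                   swapVars a b (prodₚ xs) ≋ prodₚ (List.map (swapVars a b) xs)
  swapVars-prodₚ a b []       = swapVars-one a b
  swapVars-prodₚ a b (x ∷ xs) = ≋-trans (swapVars-* a b x (prodₚ xs)) (*-congˡ≋ (swapVars a b x) (swapVars-prodₚ a b xs))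

module IndexLists where
  open P using (refl; sym; trans; cong; cong₂)
  open ExponentVectors

  uniqueSameMembers⇒↭ : ∀ {A : Set} {xs ys : List A} → Unique xs → Unique ys →
    (∀ {x} → x ∈ xs → x ∈ ys) → (∀ {x} → x ∈ ys → x ∈ xs) → xs ↭ ys
  uniqueSameMembers⇒↭ ux uy xs⊆ys ys⊆xs = ∼bag⇒↭ (unique∧set⇒bag ux uy (mk⇔ xs⊆ys ys⊆xs))

  involution-↭ : ∀ {A : Set} (f : A → A) → (∀ x → f (f x) ≡ x) → ∀ xs → Unique xs →
                 (∀ {y} → y ∈ xs → f y ∈ xs) → List.map f xs ↭ xs
  involution-↭ f f∘f≡id xs u closed = uniqueSameMembers⇒↭ (UniqueP.map⁺ f-injective u) u
    (λ m → preimage (∈-map⁻ f m))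
    (λ {x} m → P.subst (_∈ List.map f xs) (f∘f≡id x) (∈-map⁺ f (closed m)))
    where
    f-injective : ∀ {x y} → f x ≡ f y → x ≡ y
    f-injective {x} {y} fx≡fy = trans (sym (f∘f≡id x)) (trans (cong f fx≡fy) (f∘f≡id y))
    preimage : ∀ {x} → Σ[ y ∈ _ ] (y ∈ xs × x ≡ f y) → x ∈ xs
    preimage (y , m , refl) = closed m

  τ-closed : ∀ {n} (a b : Fin n) xs → a ∈ xs → b ∈ xs → ∀ {y} → y ∈ xs → τ a b y ∈ xs
  τ-closed a b xs a∈xs b∈xs {y} y∈xs with transpositionCase a b y
  ... | atLeft refl    rewrite τ-left a b = b∈xs
  ... | atRight _ refl rewrite τ-right a b = a∈xs
  ... | elsewhere y≢a y≢b rewrite τ-other a b y y≢a y≢b = y∈xs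

  Linked-mapWith∈ : ∀ {A : Set} {p q} {Q : A → A → Set p} {Q′ : A → A → Set q} xs →
    (∀ a b → a ∈ xs → b ∈ xs → Q a b → Q′ a b) → Linked Q xs → Linked Q′ xs
  Linked-mapWith∈ []           f []         = []
  Linked-mapWith∈ (a ∷ [])     f [-]        = [-]
  Linked-mapWith∈ (a ∷ b ∷ xs) f (q ∷ rest) = f a b (here refl) (there (here refl)) q ∷
    Linked-mapWith∈ (b ∷ xs) (λ a′ b′ a′∈ b′∈ → f a′ b′ (there a′∈) (there b′∈)) rest

  staircase : ∀ {n} → List (Fin n) → Vec ℕ n
  staircase []       = 𝟎
  staircase (i ∷ xs) = staircase xs ⊕ single i (List.length xs)

  Staircase : ∀ {n} → Vec ℕ n → List (Fin n) → Set
  Staircase y []       = ⊤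
  Staircase y (j ∷ ys) = (lookup y j ≡ List.length ys) × Staircase y ys

  Staircase-raise : ∀ {n} (y : Vec ℕ n) p k ys → p ∉ ys → Staircase y ys → Staircase (y ⊕ single p k) ys
  Staircase-raise y p k []       _    _            = tt
  Staircase-raise y p k (j ∷ ys) p∉ys (yj , stair) =
    trans (raise-other y p j k (p∉ys ∘ here)) yj , Staircase-raise y p k ys (p∉ys ∘ there) stair

  staircase-outside : ∀ {n} (p : Fin n) xs → p ∉ xs → lookup (staircase xs) p ≡ 0
  staircase-outside p []       _    = VP.lookup-replicate p 0
  staircase-outside p (j ∷ xs) p∉xs =
    trans (raise-other (staircase xs) j p (List.length xs) (p∉xs ∘ here ∘ sym)) (staircase-outside p xs (p∉xs ∘ there))

  staircase-isStaircase : ∀ {n} (xs : List (Fin n)) → Unique xs → Staircase (staircase xs) xs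
  staircase-isStaircase []       _           = tt
  staircase-isStaircase (j ∷ xs) u@(_ ∷ uxs) =
    trans (raise-same (staircase xs) j (List.length xs)) (cong (N._+ List.length xs) (staircase-outside j xs j∉xs))
    , Staircase-raise (staircase xs) j (List.length xs) xs j∉xs (staircase-isStaircase xs uxs)
    where j∉xs = Unique[x∷xs]⇒x∉xs u

  pairsOf : ∀ {n} → List (Fin n) → List (Fin n × Fin n)
  pairsOf []       = []
  pairsOf (i ∷ xs) = List.map (i ,_) xs ++ pairsOf xs

  staircase-map-suc : ∀ {n} (xs : List (Fin n)) → staircase (List.map F.suc xs) ≡ 0 ∷ staircase xs
  staircase-map-suc []       = refl
  staircase-map-suc (j ∷ xs) rewrite staircase-map-suc xs | LP.length-map F.suc xs = refl

  staircase-allFin : ∀ n (p : Fin n) → lookup (staircase (List.allFin n)) p ≡ n N.∸ suc (toℕ p)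
  staircase-allFin (suc n) p rewrite P.sym (LP.map-tabulate {n = n} (λ i → i) F.suc)
                                   | staircase-map-suc (List.allFin n)
                                   | LP.length-map F.suc (List.allFin n) | LP.length-tabulate {n = n} (λ i → i) = entry p
    where
    entry : ∀ p → lookup ((0 ∷ staircase (List.allFin n)) ⊕ single zero n) p ≡ suc n N.∸ suc (toℕ p)
    entry zero    = refl
    entry (suc q) = trans (cong (λ v → lookup v q) (⊕-identityʳ (staircase (List.allFin n)))) (staircase-allFin n q)

  intDiff-staircase : ∀ n c → intDiff (replicate n c) (staircase (List.allFin n))
                              ≡ tabulate (λ i → (Z.+ suc c Z.- Z.+ n) Z.+ Z.+ toℕ i)
  intDiff-staircase n c = vecExt _ _ λ i → begin
    lookup (intDiff (replicate n c) (staircase (List.allFin n))) i  ≡⟨ VP.lookup-zipWith _ i (replicate n c) _ ⟩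
    Z.+ lookup (replicate n c) i Z.- Z.+ lookup (staircase (List.allFin n)) i
                                ≡⟨ cong₂ (λ a b → Z.+ a Z.- Z.+ b) (VP.lookup-replicate i c) (staircase-allFin n i) ⟩
    Z.+ c Z.- Z.+ (n N.∸ suc (toℕ i))
                                ≡⟨ cong (λ x → Z.+ c Z.- x) (trans (sym (ZP.⊖-≥ (FinP.toℕ<n i))) (sym (ZP.m-n≡m⊖n n (suc (toℕ i))))) ⟩
    Z.+ c Z.- (Z.+ n Z.- (Z.+ 1 Z.+ Z.+ toℕ i))
                                ≡⟨ shift (Z.+ c) (Z.+ n) (Z.+ toℕ i) ⟩
    (Z.+ suc c Z.- Z.+ n) Z.+ Z.+ toℕ i
                                ≡⟨ VP.lookup∘tabulate _ i ⟨
    lookup (tabulate (λ i → (Z.+ suc c Z.- Z.+ n) Z.+ Z.+ toℕ i)) i ∎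
    where
    open P.≡-Reasoning
    open +-*-Solver using (solve; _:+_; _:-_; _:=_; con)
    shift : ∀ c n i → c Z.- (n Z.- (Z.+ 1 Z.+ i)) ≡ ((Z.+ 1 Z.+ c) Z.- n) Z.+ i
    shift = solve 3 (λ c n i → c :- (n :- (con (Z.+ 1) :+ i)) := ((con (Z.+ 1) :+ c) :- n) :+ i) refl

module Extraction {c ℓ} (R : CommutativeRing c ℓ) where
  open CommutativeRing R
  open Poly R
  open PolyAlgebra R
  open ExponentVectors
  open IndexLists
  open import Relation.Binary.Reasoning.Setoid setoid
  open import Algebra.Properties.Ring ring using (-‿involutive; -0#≈0#; -‿+-comm; ⁻¹-anti-homo‿-)

  ·-cong : ∀ k {x y} → x ≈ y → k · x ≈ k · y
  ·-cong zero    x≈y = refl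
  ·-cong (suc k) x≈y = +-cong x≈y (·-cong k x≈y)

  ·-negate : ∀ k x → k · (- x) ≈ - (k · x)
  ·-negate zero    x = sym -0#≈0#
  ·-negate (suc k) x = trans (+-congˡ (·-negate k x)) (-‿+-comm _ _)

  ·-zero : ∀ k → k · 0# ≈ 0#
  ·-zero zero    = refl
  ·-zero (suc k) = trans (+-identityˡ _) (·-zero k)

  ·-+ : ∀ k l x → (k N.+ l) · x ≈ k · x + l · x
  ·-+ zero    l x = sym (+-identityˡ _)
  ·-+ (suc k) l x = trans (+-congˡ (·-+ k l x)) (sym (+-assoc _ _ _))

  ·-* : ∀ k l x → (k N.* l) · x ≈ k · (l · x)
  ·-* zero    l x = refl
  ·-* (suc k) l x = trans (·-+ l (k N.* l) x) (+-congˡ (·-* k l x))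

  VanishesOnDiagonal : ∀ {n} → Mono n → Pol n → Fin n → Fin n → Set ℓ
  VanishesOnDiagonal t K a b = ∀ z → lookup z a ≡ lookup z b → shiftedCoeff K t z ≈ 0#

  Antisymmetric : ∀ {n} → Mono n → Pol n → Fin n → Fin n → Set ℓ
  Antisymmetric t K a b = ∀ z → shiftedCoeff K t (swapExp a b z) ≈ - shiftedCoeff K t z

  -- Antisymmetry in consecutive members of a list gives antisymmetry in the
  -- head and any later member, since (i j) = (i p)(p j)(i p).
  Antisymmetric-fromLinked : ∀ {n} (t : Mono n) K i xs → Unique (i ∷ xs) → Linked (Antisymmetric t K) (i ∷ xs) →
                             ∀ j → j ∈ xs → Antisymmetric t K i j
  Antisymmetric-fromLinked t K i (p ∷ xs) u (anti-ip ∷ rest) j (here P.refl) = anti-ip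
  Antisymmetric-fromLinked t K i (p ∷ xs) u@((i≢p ∷ _) ∷ up@(_ ∷ _)) (anti-ip ∷ rest) j (there j∈xs) z = begin
    shiftedCoeff K t (swapExp i j z)                                ≡⟨ P.cong (shiftedCoeff K t) (swapExp-conjugate i p j i≢p p≢j i≢j z) ⟩
    shiftedCoeff K t (swapExp i p (swapExp p j (swapExp i p z)))    ≈⟨ anti-ip (swapExp p j (swapExp i p z)) ⟩
    - shiftedCoeff K t (swapExp p j (swapExp i p z))                ≈⟨ -‿cong (Antisymmetric-fromLinked t K p xs up rest j j∈xs (swapExp i p z)) ⟩
    - - shiftedCoeff K t (swapExp i p z)                            ≈⟨ -‿involutive _ ⟩
    shiftedCoeff K t (swapExp i p z)                                ≈⟨ anti-ip z ⟩
    - shiftedCoeff K t z                                            ∎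
    where
    i≢j : i ≢ j
    i≢j P.refl = Unique[x∷xs]⇒x∉xs u (there j∈xs)
    p≢j : p ≢ j
    p≢j P.refl = Unique[x∷xs]⇒x∉xs up j∈xs

  rowProduct : ∀ {n} → Fin n → List (Fin n) → Pol n
  rowProduct i ys = prodₚ (List.map (diff i) ys)

  module RowExpansion {n} (t : Mono n) (K : Pol n) (i : Fin n) where
    g : Mono n → Carrier
    g = shiftedCoeff K t

    S : List (Fin n) → Mono n → Carrier
    S ys = shiftedCoeff (rowProduct i ys *ₚ K) t

    S-nil : ∀ y → S [] y ≈ g y
    S-nil y = sameCoeffs (*-identityˡ≋ K) t y

    S-cons : ∀ j ys y → S (j ∷ ys) y ≈ S ys (y ⊕ single i 1) - S ys (y ⊕ single j 1)
    S-cons j ys y = trans (sameCoeffs (*-assoc≋ (diff i j) (rowProduct i ys) K) t y)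
                          (shiftedCoeff-diff* i j (rowProduct i ys *ₚ K) t y)

    S-vanishes : ∀ ys y a b → VanishesOnDiagonal t K a b → a ∉ ys → b ∉ ys → a ≢ i → b ≢ i →
                 lookup y a ≡ lookup y b → S ys y ≈ 0#
    S-vanishes []       y a b van _    _    _   _   ya≡yb = trans (S-nil y) (van y ya≡yb)
    S-vanishes (j ∷ ys) y a b van a∉ b∉ a≢i b≢i ya≡yb = begin
      S (j ∷ ys) y                                          ≈⟨ S-cons j ys y ⟩
      S ys (y ⊕ single i 1) - S ys (y ⊕ single j 1)         ≈⟨ +-cong (vanishesAfter i (a≢i ∘ P.sym) (b≢i ∘ P.sym))
                                                                      (-‿cong (vanishesAfter j (a∉ ∘ here ∘ P.sym) (b∉ ∘ here ∘ P.sym))) ⟩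
      0# - 0#                                               ≈⟨ +-congˡ -0#≈0# ⟩
      0# + 0#                                               ≈⟨ +-identityʳ _ ⟩
      0#                                                    ∎
      where
      vanishesAfter : ∀ p → p ≢ a → p ≢ b → S ys (y ⊕ single p 1) ≈ 0#
      vanishesAfter p p≢a p≢b = S-vanishes ys (y ⊕ single p 1) a b van (a∉ ∘ there) (b∉ ∘ there) a≢i b≢i
        (P.trans (raise-other y p a 1 p≢a) (P.trans ya≡yb (P.sym (raise-other y p b 1 p≢b))))

    -- On a staircase continuing a list q, ys with K vanishing on consecutive
    -- diagonals, every choice of some -x_j creates a collision, so only the
    -- term x_i^|ys| survives.
    S-collapse : ∀ ys y q → Staircase y ys → lookup y q ≡ List.length ys → q ≢ i → Unique (q ∷ ys) → i ∉ ys →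
                 Linked (VanishesOnDiagonal t K) (q ∷ ys) → S ys y ≈ g (y ⊕ single i (List.length ys))
    S-collapse [] y q _ _ _ _ _ _ = trans (S-nil y) (reflexive (P.cong g (P.sym (raise-zero y i))))
    S-collapse (j ∷ ys) y q (yj , stair) yq q≢i u@(_ ∷ uys) i∉ (van-qj ∷ vans) = begin
      S (j ∷ ys) y                                          ≈⟨ S-cons j ys y ⟩
      S ys (y ⊕ single i 1) - S ys (y ⊕ single j 1)         ≈⟨ +-cong taking-xi (-‿cong taking-xj) ⟩
      g (y ⊕ single i (suc (List.length ys))) - 0#          ≈⟨ +-congˡ -0#≈0# ⟩
      g (y ⊕ single i (suc (List.length ys))) + 0#          ≈⟨ +-identityʳ _ ⟩
      g (y ⊕ single i (suc (List.length ys)))               ∎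
      where
      j≢i : j ≢ i
      j≢i j≡i = i∉ (here (P.sym j≡i))
      q∉ : q ∉ j ∷ ys
      q∉ = Unique[x∷xs]⇒x∉xs u
      taking-xi : S ys (y ⊕ single i 1) ≈ g (y ⊕ single i (suc (List.length ys)))
      taking-xi = trans
        (S-collapse ys (y ⊕ single i 1) j (Staircase-raise y i 1 ys (i∉ ∘ there) stair)
                    (P.trans (raise-other y i j 1 (j≢i ∘ P.sym)) yj) j≢i uys (i∉ ∘ there) vans)
        (reflexive (P.cong g (raise-raise y i 1 (List.length ys))))
      -- after taking x_j, the exponents of x_q and x_j coincide
      taking-xj : S ys (y ⊕ single j 1) ≈ 0#
      taking-xj = S-vanishes ys (y ⊕ single j 1) q j van-qj (q∉ ∘ there) (Unique[x∷xs]⇒x∉xs uys) q≢i j≢i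
        (P.trans (raise-other y j q 1 (q∉ ∘ here ∘ P.sym))
          (P.trans yq (P.trans (NP.+-comm 1 (List.length ys)) (P.sym (P.trans (raise-same y j 1) (P.cong (N._+ 1) yj))))))

    raise-as-swap : ∀ (y : Mono n) j k → i ≢ j → lookup y i ≡ 0 → lookup y j ≡ k →
                    (y ⊕ single j 1) ⊕ single i k ≡ swapExp i j (y ⊕ single i (suc k))
    raise-as-swap y j k i≢j yi yj = vecExt _ _ λ p →
      P.trans (entry p (transpositionCase i j p)) (P.sym (lookup-swapExp i j (y ⊕ single i (suc k)) p))
      where
      entry : ∀ p → TranspositionCase i j p → lookup ((y ⊕ single j 1) ⊕ single i k) p ≡ lookup (y ⊕ single i (suc k)) (τ i j p)
      entry p (atLeft P.refl) rewrite τ-left i j =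
        P.trans (raise-same (y ⊕ single j 1) i k) (P.trans (P.cong (N._+ k) (P.trans (raise-other y j i 1 (i≢j ∘ P.sym)) yi))
          (P.trans (P.sym yj) (P.sym (raise-other y i j (suc k) i≢j))))
      entry p (atRight _ P.refl) rewrite τ-right i j =
        P.trans (raise-other (y ⊕ single j 1) i j k i≢j) (P.trans (raise-same y j 1) (P.trans (P.cong (N._+ 1) yj)
          (P.trans (NP.+-comm k 1) (P.sym (P.trans (raise-same y i (suc k)) (P.cong (N._+ suc k) yi))))))
      entry p (elsewhere p≢i p≢j) rewrite τ-other i j p p≢i p≢j =
        P.trans (raise-other (y ⊕ single j 1) i p k (p≢i ∘ P.sym))
          (P.trans (raise-other y j p 1 (p≢j ∘ P.sym)) (P.sym (raise-other y i p (suc k) (p≢i ∘ P.sym))))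

    S-expand : ∀ ys y → Staircase y ys → lookup y i ≡ 0 → Unique (i ∷ ys) → Linked (VanishesOnDiagonal t K) ys →
               (∀ j → j ∈ ys → Antisymmetric t K i j) →
               S ys y ≈ suc (List.length ys) · g (y ⊕ single i (List.length ys))
    S-expand [] y _ _ _ _ _ = trans (S-nil y) (trans (reflexive (P.cong g (P.sym (raise-zero y i)))) (sym (+-identityʳ _)))
    S-expand (j ∷ ys) y (yj , stair) yi ((i≢j ∷ i∉) ∷ uys) vans anti = begin
      S (j ∷ ys) y                                    ≈⟨ S-cons j ys y ⟩
      S ys (y ⊕ single i 1) - S ys (y ⊕ single j 1)   ≈⟨ +-cong taking-xi (-‿cong taking-xj) ⟩
      g Y - suc k · (- g Y)                           ≈⟨ +-congˡ (trans (-‿cong (·-negate (suc k) (g Y))) (-‿involutive _)) ⟩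
      suc (suc k) · g Y                               ∎
      where
      k = List.length ys
      Y = y ⊕ single i (suc k)
      j≢i : j ≢ i
      j≢i = i≢j ∘ P.sym
      i∉ys : i ∉ ys
      i∉ys = All¬⇒¬Any i∉
      taking-xi : S ys (y ⊕ single i 1) ≈ g Y
      taking-xi = trans
        (S-collapse ys (y ⊕ single i 1) j (Staircase-raise y i 1 ys i∉ys stair)
                    (P.trans (raise-other y i j 1 i≢j) yj) j≢i uys i∉ys vans)
        (reflexive (P.cong g (raise-raise y i 1 k)))
      taking-xj : S ys (y ⊕ single j 1) ≈ suc k · (- g Y)
      taking-xj = trans
        (S-expand ys (y ⊕ single j 1) (Staircase-raise y j 1 ys (Unique[x∷xs]⇒x∉xs uys) stair)
                  (P.trans (raise-other y j i 1 j≢i) yi) (i∉ ∷ UniqueTail uys) (LinkedTail vans) (λ j′ m → anti j′ (there m)))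
        (·-cong (suc k) (trans (reflexive (P.cong g (raise-as-swap y j k i≢j yi yj))) (anti j (here P.refl) Y)))

  Alternating : ∀ {n} → Pol n → Fin n → Fin n → Set (c ⊔ ℓ)
  Alternating K a b = Σ[ M ∈ Pol _ ] ((K ≋ diff a b *ₚ M) × (swapVars a b M ≋ M))

  module _ {n} (t : Mono n) (t-invariant : ∀ a b → swapExp a b t ≡ t) where

    private
      invariant-coeffs : ∀ (a b : Fin n) M → swapVars a b M ≋ M → ∀ y →
                         shiftedCoeff M t y ≈ shiftedCoeff M t (swapExp a b y)
      invariant-coeffs a b M inv y = begin
        shiftedCoeff M t y                                    ≈⟨ sameCoeffs (≋-sym inv) t y ⟩
        shiftedCoeff (swapVars a b M) t y                     ≈⟨ shiftedCoeff-swapVars a b M t y ⟩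
        shiftedCoeff M (swapExp a b t) (swapExp a b y)        ≡⟨ P.cong (λ u → shiftedCoeff M u (swapExp a b y)) (t-invariant a b) ⟩
        shiftedCoeff M t (swapExp a b y)                      ∎

    Alternating⇒vanishes : ∀ K a b → Alternating K a b → VanishesOnDiagonal t K a b
    Alternating⇒vanishes K a b (M , K≋ , inv) z za≡zb = begin
      shiftedCoeff K t z                                                              ≈⟨ sameCoeffs K≋ t z ⟩
      shiftedCoeff (diff a b *ₚ M) t z                                                ≈⟨ shiftedCoeff-diff* a b M t z ⟩
      shiftedCoeff M t (z ⊕ single a 1) - shiftedCoeff M t (z ⊕ single b 1)          ≈⟨ +-congʳ (invariant-coeffs a b M inv (z ⊕ single a 1)) ⟩
      shiftedCoeff M t (swapExp a b (z ⊕ single a 1)) - shiftedCoeff M t (z ⊕ single b 1)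
        ≡⟨ P.cong (λ u → shiftedCoeff M t u - shiftedCoeff M t (z ⊕ single b 1))
                  (P.trans (swapExp-raise-left a b z) (P.cong (_⊕ single b 1) (swapExp-fixed a b z za≡zb))) ⟩
      shiftedCoeff M t (z ⊕ single b 1) - shiftedCoeff M t (z ⊕ single b 1)          ≈⟨ -‿inverseʳ _ ⟩
      0#                                                                              ∎

    Alternating⇒antisymmetric : ∀ K a b → Alternating K a b → Antisymmetric t K a b
    Alternating⇒antisymmetric K a b (M , K≋ , inv) z = begin
      shiftedCoeff K t (s z)                                                  ≈⟨ sameCoeffs K≋ t (s z) ⟩
      shiftedCoeff (diff a b *ₚ M) t (s z)                                    ≈⟨ shiftedCoeff-diff* a b M t (s z) ⟩
      shiftedCoeff M t (s z ⊕ single a 1) - shiftedCoeff M t (s z ⊕ single b 1)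
        ≈⟨ +-cong (invariant-coeffs a b M inv (s z ⊕ single a 1)) (-‿cong (invariant-coeffs a b M inv (s z ⊕ single b 1))) ⟩
      shiftedCoeff M t (s (s z ⊕ single a 1)) - shiftedCoeff M t (s (s z ⊕ single b 1))
        ≡⟨ P.cong₂ (λ v w → shiftedCoeff M t v - shiftedCoeff M t w)
             (P.trans (swapExp-raise-left a b (s z)) (P.cong (_⊕ single b 1) (swapExp-involutive a b z)))
             (P.trans (swapExp-raise-right a b (s z)) (P.cong (_⊕ single a 1) (swapExp-involutive a b z))) ⟩
      shiftedCoeff M t (z ⊕ single b 1) - shiftedCoeff M t (z ⊕ single a 1)  ≈⟨ sym (⁻¹-anti-homo‿- _ _) ⟩
      - (shiftedCoeff M t (z ⊕ single a 1) - shiftedCoeff M t (z ⊕ single b 1)) ≈⟨ -‿cong (sym (shiftedCoeff-diff* a b M t z)) ⟩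
      - shiftedCoeff (diff a b *ₚ M) t z                                      ≈⟨ -‿cong (sameCoeffs (≋-sym K≋) t z) ⟩
      - shiftedCoeff K t z                                                    ∎
      where s = swapExp a b

  -- A row product over a list containing a and b, but not i, is invariant
  -- under x_a ↔ x_b: the swap only permutes its factors.
  rowProduct-invariant : ∀ {n} (a b i : Fin n) xs → i ∉ xs → Unique xs → a ∈ xs → b ∈ xs →
                         swapVars a b (rowProduct i xs) ≋ rowProduct i xs
  rowProduct-invariant a b i xs i∉xs u a∈xs b∈xs =
    ≋-trans (swapVars-prodₚ a b (List.map (diff i) xs))
    (≋-trans (≋-reflexive (P.cong prodₚ (swapped-factors xs)))
             (prodₚ-↭ (↭P.map⁺ (diff i) (involution-↭ (τ a b) (τ-involutive a b) xs u (τ-closed a b xs a∈xs b∈xs)))))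
    where
    τi≡i : τ a b i ≡ i
    τi≡i = τ-other a b i (λ i≡a → i∉xs (P.subst (_∈ xs) (P.sym i≡a) a∈xs)) (λ i≡b → i∉xs (P.subst (_∈ xs) (P.sym i≡b) b∈xs))
    swapped-factors : ∀ ys → List.map (swapVars a b) (List.map (diff i) ys) ≡ List.map (diff i) (List.map (τ a b) ys)
    swapped-factors []       = P.refl
    swapped-factors (j ∷ ys) =
      P.cong₂ _∷_ (P.trans (swapVars-diff a b i j) (P.cong (λ u → diff u (τ a b j)) τi≡i)) (swapped-factors ys)

  Alternating-rowProduct : ∀ {n} (i : Fin n) xs K a b → i ∉ xs → Unique xs → a ∈ xs → b ∈ xs →
                           Alternating K a b → Alternating (rowProduct i xs *ₚ K) a b
  Alternating-rowProduct i xs K a b i∉xs u a∈xs b∈xs (M , K≋ , inv) =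
    rowProduct i xs *ₚ M ,
    ≋-trans (*-congˡ≋ (rowProduct i xs) K≋) (*-leftComm≋ (rowProduct i xs) (diff a b) M) ,
    ≋-trans (swapVars-* a b (rowProduct i xs) M) (*-cong≋ (rowProduct-invariant a b i xs i∉xs u a∈xs b∈xs) inv)

  vandermondeOf : ∀ {n} → List (Fin n) → Pol n
  vandermondeOf xs = prodₚ (List.map (λ { (i , j) → diff i j }) (pairsOf xs))

  vandermondeOf-cons : ∀ {n} (i : Fin n) xs → vandermondeOf (i ∷ xs) ≋ rowProduct i xs *ₚ vandermondeOf xs
  vandermondeOf-cons i xs =
    ≋-trans (≋-reflexive (P.cong prodₚ (LP.map-++ _ (List.map (i ,_) xs) (pairsOf xs))))
    (≋-trans (prodₚ-++ (List.map _ (List.map (i ,_) xs)) _)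
             (*-congʳ≋ (vandermondeOf xs) (≋-reflexive (P.cong prodₚ (P.sym (LP.map-∘ xs))))))

  -- Induction on xs: the head row is expanded by S-expand, and multiplying K
  -- by that row keeps it alternating in the remaining consecutive pairs.
  extraction : ∀ {n} (t : Mono n) → (∀ a b → swapExp a b t ≡ t) → ∀ xs K → Unique xs → Linked (Alternating K) xs →
               shiftedCoeff (vandermondeOf xs *ₚ K) t 𝟎 ≈ (List.length xs N.!) · shiftedCoeff K t (staircase xs)
  extraction t t-inv []       K _ _ = trans (sameCoeffs (*-identityˡ≋ K) t 𝟎) (sym (+-identityʳ _))
  extraction t t-inv (i ∷ xs) K u@(i∉ ∷ uxs) alts = begin
    shiftedCoeff (vandermondeOf (i ∷ xs) *ₚ K) t 𝟎                ≈⟨ sameCoeffs regroup t 𝟎 ⟩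
    shiftedCoeff (vandermondeOf xs *ₚ (rowProduct i xs *ₚ K)) t 𝟎  ≈⟨ extraction t t-inv xs (rowProduct i xs *ₚ K) uxs alts′ ⟩
    (k N.!) · shiftedCoeff (rowProduct i xs *ₚ K) t (staircase xs) ≈⟨ ·-cong (k N.!) row ⟩
    (k N.!) · (suc k · shiftedCoeff K t (staircase (i ∷ xs)))     ≈⟨ sym (·-* (k N.!) (suc k) _) ⟩
    (k N.! N.* suc k) · shiftedCoeff K t (staircase (i ∷ xs))     ≡⟨ P.cong (_· shiftedCoeff K t (staircase (i ∷ xs))) (NP.*-comm (k N.!) (suc k)) ⟩
    (suc k N.!) · shiftedCoeff K t (staircase (i ∷ xs))           ∎
    where
    k = List.length xs
    i∉xs = Unique[x∷xs]⇒x∉xs u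
    regroup : vandermondeOf (i ∷ xs) *ₚ K ≋ vandermondeOf xs *ₚ (rowProduct i xs *ₚ K)
    regroup = ≋-trans (*-congʳ≋ K (vandermondeOf-cons i xs))
              (≋-trans (*-assoc≋ (rowProduct i xs) (vandermondeOf xs) K) (*-leftComm≋ (rowProduct i xs) (vandermondeOf xs) K))
    alts′ : Linked (Alternating (rowProduct i xs *ₚ K)) xs
    alts′ = Linked-mapWith∈ xs (λ a b a∈ b∈ → Alternating-rowProduct i xs K a b i∉xs uxs a∈ b∈) (LinkedTail alts)
    row : shiftedCoeff (rowProduct i xs *ₚ K) t (staircase xs) ≈ suc k · shiftedCoeff K t (staircase (i ∷ xs))
    row = RowExpansion.S-expand t K i xs (staircase xs) (staircase-isStaircase xs uxs) (staircase-outside i xs i∉xs) u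
            (LinkedMap (λ {a} {b} → Alternating⇒vanishes t t-inv K a b) (LinkedTail alts))
            (Antisymmetric-fromLinked t K i xs u (LinkedMap (λ {a} {b} → Alternating⇒antisymmetric t t-inv K a b) alts))

module Coefficients {c ℓ} (R : CommutativeRing c ℓ) where
  open CommutativeRing R
  open Poly R
  open PolyAlgebra R
  open ExponentVectors
  open import Relation.Binary.Reasoning.Setoid setoid

  shiftedCoeff-≤ : ∀ {n} (Q : Pol n) t y → y ≤ᵥ t → shiftedCoeff Q t y ≈ coeff Q (t ∸ᵥ y)
  shiftedCoeff-≤ []            t y y≤t = refl
  shiftedCoeff-≤ ((a , f) ∷ Q) t y y≤t with VP.≡-dec N._≟_ (y ⊕ f) t | VP.≡-dec N._≟_ f (t ∸ᵥ y)
  ... | yes _  | yes _  = +-cong (*-identityʳ a) (shiftedCoeff-≤ Q t y y≤t)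
  ... | no _   | no _   = trans (+-congʳ (zeroʳ a)) (trans (+-identityˡ _) (shiftedCoeff-≤ Q t y y≤t))
  ... | yes eq | no ne  = ⊥-elim (ne (⊕≡⇒≡∸ᵥ y t f eq))
  ... | no ne  | yes eq = ⊥-elim (ne (P.trans (P.cong (y ⊕_) eq) (≡∸ᵥ⇒⊕≡ y t y≤t)))

  shiftedCoeff-≰ : ∀ {n} (Q : Pol n) t y → ¬ y ≤ᵥ t → shiftedCoeff Q t y ≈ 0#
  shiftedCoeff-≰ []            t y y≰t = refl
  shiftedCoeff-≰ ((a , f) ∷ Q) t y y≰t with VP.≡-dec N._≟_ (y ⊕ f) t
  ... | yes eq = ⊥-elim (y≰t (⊕≡⇒≤ᵥ y t f eq))
  ... | no _   = trans (+-congʳ (zeroʳ a)) (trans (+-identityˡ _) (shiftedCoeff-≰ Q t y y≰t))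

  coeff≈shiftedCoeff : ∀ {n} (Q : Pol n) e → coeff Q e ≈ shiftedCoeff Q e 𝟎
  coeff≈shiftedCoeff Q e = begin
    coeff Q e          ≡⟨ P.cong (coeff Q) (VP.zipWith-identityʳ (λ _ → P.refl) e) ⟨
    coeff Q (e ∸ᵥ 𝟎)   ≈⟨ shiftedCoeff-≤ Q e 𝟎 (λ i → P.subst (N._≤ lookup e i) (P.sym (VP.lookup-replicate i 0)) N.z≤n) ⟨
    shiftedCoeff Q e 𝟎 ∎

  Symmetric⇒swapVars-invariant : ∀ {n} (L : Pol n) → Symmetric L → ∀ a b → swapVars a b L ≋ L
  Symmetric⇒swapVars-invariant L symL a b = mk≋ λ t y →
    trans (shiftedCoeff-swapVars a b L t y) (swapped t y (y ≤ᵥ? t))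
    where
    s = swapExp a b
    swap-≤ᵥ : ∀ u v → u ≤ᵥ v → s u ≤ᵥ s v
    swap-≤ᵥ u v u≤v i = P.subst₂ N._≤_ (P.sym (lookup-swapExp a b u i)) (P.sym (lookup-swapExp a b v i)) (u≤v (τ a b i))
    swap-∸ᵥ : ∀ u v → s (u ∸ᵥ v) ≡ s u ∸ᵥ s v
    swap-∸ᵥ u v = vecExt _ _ λ i → P.trans (lookup-swapExp a b (u ∸ᵥ v) i) (P.trans (lookup-∸ᵥ u v (τ a b i))
      (P.trans (P.cong₂ N._∸_ (P.sym (lookup-swapExp a b u i)) (P.sym (lookup-swapExp a b v i))) (P.sym (lookup-∸ᵥ (s u) (s v) i))))
    swapped : ∀ t y → Dec (y ≤ᵥ t) → shiftedCoeff L (s t) (s y) ≈ shiftedCoeff L t y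
    swapped t y (yes y≤t) = begin
      shiftedCoeff L (s t) (s y) ≈⟨ shiftedCoeff-≤ L (s t) (s y) (swap-≤ᵥ y t y≤t) ⟩
      coeff L (s t ∸ᵥ s y)       ≡⟨ P.cong (coeff L) (swap-∸ᵥ t y) ⟨
      coeff L (s (t ∸ᵥ y))       ≈⟨ symL (transpose a b) (t ∸ᵥ y) ⟩
      coeff L (t ∸ᵥ y)           ≈⟨ shiftedCoeff-≤ L t y y≤t ⟨
      shiftedCoeff L t y         ∎
    swapped t y (no y≰t) = trans (shiftedCoeff-≰ L (s t) (s y) sy≰st) (sym (shiftedCoeff-≰ L t y y≰t))
      where
      sy≰st : ¬ s y ≤ᵥ s t
      sy≰st sy≤st = y≰t (P.subst₂ _≤ᵥ_ (swapExp-involutive a b y) (swapExp-involutive a b t) (swap-≤ᵥ (s y) (s t) sy≤st))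

  toℕs-nonneg : ∀ {n} (v : Vec ℤ n) (e : Vec ℕ n) → (∀ i → lookup v i ≡ Z.+ lookup e i) → toℕs v ≡ just e
  toℕs-nonneg []      []      _ = P.refl
  toℕs-nonneg (x ∷ v) (a ∷ e) h rewrite h F.zero | toℕs-nonneg v e (h ∘ F.suc) = P.refl

  toℕs-negative : ∀ {n} (v : Vec ℤ n) i x → lookup v i ≡ -[1+ x ] → toℕs v ≡ nothing
  toℕs-negative (_ ∷ v) zero    x P.refl = P.refl
  toℕs-negative (Z.+ a ∷ v) (suc i) x vi rewrite toℕs-negative v i x vi = P.refl
  toℕs-negative (-[1+ _ ] ∷ v) (suc i) x vi = P.refl

  shiftedCoeff≈coeffℤ : ∀ {n} (Q : Pol n) t y → shiftedCoeff Q t y ≈ coeffℤ Q (intDiff t y)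
  shiftedCoeff≈coeffℤ Q t y with y ≤ᵥ? t
  ... | yes y≤t rewrite toℕs-nonneg (intDiff t y) (t ∸ᵥ y) (lookup-intDiff-≤ t y y≤t) = shiftedCoeff-≤ Q t y y≤t
  ... | no y≰t with FinP.¬∀⟶∃¬ _ _ (λ i → lookup y i N.≤? lookup t i) y≰t
  ...   | i , yi≰ti rewrite toℕs-negative (intDiff t y) i _ (lookup-intDiff-> t y i (NP.≰⇒> yi≰ti)) =
          shiftedCoeff-≰ Q t y y≰t

  coeffℤ-replicate : ∀ {n} (Q : Pol n) c → coeffℤ Q (replicate n (Z.+ c)) ≡ coeff Q (replicate n c)
  coeffℤ-replicate {n} Q c rewrite toℕs-nonneg (replicate n (Z.+ c)) (replicate n c)
                                     (λ i → P.trans (VP.lookup-replicate i (Z.+ c)) (P.cong Z.+_ (P.sym (VP.lookup-replicate i c)))) = P.refl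

module OrderedPairs where
  open P using (refl; sym; trans; cong)
  open ExponentVectors
  open IndexLists

  allFin-sorted : ∀ n → AllPairs F._<_ (List.allFin n)
  allFin-sorted n = AllPairsP.tabulate⁺-< (λ i<j → i<j)

  ∈-pairsOf⇒∈ : ∀ {n} {x y : Fin n} xs → (x , y) ∈ pairsOf xs → x ∈ xs
  ∈-pairsOf⇒∈ (i ∷ xs) m with ∈-++⁻ (List.map (i ,_) xs) m
  ... | inj₂ m′ = there (∈-pairsOf⇒∈ xs m′)
  ... | inj₁ m′ with ∈-map⁻ (i ,_) m′
  ...   | _ , _ , refl = here refl

  ∈-pairsOf⇒< : ∀ {n} {x y : Fin n} xs → AllPairs F._<_ xs → (x , y) ∈ pairsOf xs → x F.< y
  ∈-pairsOf⇒< (i ∷ xs) (i<xs ∷ sorted) m with ∈-++⁻ (List.map (i ,_) xs) m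
  ... | inj₂ m′ = ∈-pairsOf⇒< xs sorted m′
  ... | inj₁ m′ with ∈-map⁻ (i ,_) m′
  ...   | _ , j∈xs , refl = All.lookup i<xs j∈xs

  <⇒∈-pairsOf : ∀ {n} {x y : Fin n} xs → AllPairs F._<_ xs → x ∈ xs → y ∈ xs → x F.< y → (x , y) ∈ pairsOf xs
  <⇒∈-pairsOf (i ∷ xs) (i<xs ∷ sorted) (here refl) (here refl) x<y = ⊥-elim (FinP.<-irrefl refl x<y)
  <⇒∈-pairsOf (i ∷ xs) (i<xs ∷ sorted) (here refl) (there y∈) x<y = ∈-++⁺ˡ (∈-map⁺ (i ,_) y∈)
  <⇒∈-pairsOf (i ∷ xs) (i<xs ∷ sorted) (there x∈) (here refl) x<y = ⊥-elim (FinP.<-asym x<y (All.lookup i<xs x∈))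
  <⇒∈-pairsOf (i ∷ xs) (i<xs ∷ sorted) (there x∈) (there y∈) x<y =
    ∈-++⁺ʳ (List.map (i ,_) xs) (<⇒∈-pairsOf xs sorted x∈ y∈ x<y)

  sorted-suffix : ∀ {n} (us : List (Fin n)) v vs → AllPairs F._<_ (us ++ v ∷ vs) →
                  List.filter (v F.<?_) (us ++ v ∷ vs) ≡ vs
  sorted-suffix us v vs sorted = begin
    List.filter (v F.<?_) (us ++ v ∷ vs)                          ≡⟨ LP.filter-++ (v F.<?_) us (v ∷ vs) ⟩
    List.filter (v F.<?_) us ++ List.filter (v F.<?_) (v ∷ vs)   ≡⟨ P.cong₂ _++_ (LP.filter-none (v F.<?_) (All.map (λ u<v v<u → FinP.<-asym u<v v<u) below))
                                                                               (LP.filter-reject (v F.<?_) (FinP.<-irrefl P.refl)) ⟩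
    List.filter (v F.<?_) vs                                     ≡⟨ LP.filter-all (v F.<?_) above ⟩
    vs                                                            ∎
    where
    open P.≡-Reasoning
    split : ∀ us → AllPairs F._<_ (us ++ v ∷ vs) → All.All (F._< v) us × All.All (v F.<_) vs
    split []       (v<vs ∷ _)      = [] , v<vs
    split (u ∷ us) (u<rest ∷ rest) = (All.lookup u<rest (∈-++⁺ʳ us (here P.refl)) ∷ proj₁ (split us rest)) , proj₂ (split us rest)
    below = proj₁ (split us sorted)
    above = proj₂ (split us sorted)

  pairsOf-unique : ∀ {n} (xs : List (Fin n)) → AllPairs F._<_ xs → Unique (pairsOf xs)
  pairsOf-unique []       _                = []
  pairsOf-unique (i ∷ xs) (i<xs ∷ sorted) =
    UniqueP.++⁺ (UniqueP.map⁺ (cong proj₂) (AllPairs.map FinP.<⇒≢ sorted)) (pairsOf-unique xs sorted) disjoint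
    where
    disjoint : ∀ {v} → ¬ (v ∈ List.map (i ,_) xs × v ∈ pairsOf xs)
    disjoint (m₁ , m₂) with ∈-map⁻ (i ,_) m₁
    ... | _ , _ , refl = FinP.<-irrefl refl (All.lookup i<xs (∈-pairsOf⇒∈ xs m₂))

  orderedPairs : ∀ n → List (Fin n × Fin n)
  orderedPairs n = pairsOf (List.allFin n)

  ∈-orderedPairs : ∀ {n} {x y : Fin n} → x F.< y → (x , y) ∈ orderedPairs n
  ∈-orderedPairs x<y = <⇒∈-pairsOf (List.allFin _) (allFin-sorted _) (∈-allFin _) (∈-allFin _) x<y

  Consecutive : ∀ {n} → Fin n → Fin n → Set
  Consecutive a b = toℕ b ≡ suc (toℕ a)

  Linked-tabulate : ∀ {A : Set} {r} {Rel : A → A → Set r} n (f : Fin (suc n) → A) →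
                    (∀ (i : Fin n) → Rel (f (F.inject₁ i)) (f (suc i))) → Linked Rel (List.tabulate f)
  Linked-tabulate zero    f step = [-]
  Linked-tabulate (suc n) f step = step zero ∷ Linked-tabulate n (f ∘ suc) (step ∘ suc)

  allFin-consecutive : ∀ n → Linked Consecutive (List.allFin n)
  allFin-consecutive zero    = []
  allFin-consecutive (suc n) = Linked-tabulate n (λ i → i) (λ i → cong suc (sym (FinP.toℕ-inject₁ i)))

  -- For consecutive a, b, the transposition (a b) maps every pair k < l other
  -- than (a, b) to another such pair, since no index lies strictly between a and b.
  module ConsecutiveSwap {n} (a b : Fin n) (consecutive : Consecutive a b) where
    _≟ₚ_ : (p q : Fin n × Fin n) → Dec (p ≡ q)
    _≟ₚ_ = ×P.≡-dec _F≟_ _F≟_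

    others : List (Fin n × Fin n)
    others = List.filter (λ p → ¬? (p ≟ₚ (a , b))) (orderedPairs n)

    a<b : a F.< b
    a<b = P.subst (toℕ a N.<_) (sym consecutive) (NP.n<1+n (toℕ a))

    orderedPairs-unique : Unique (orderedPairs n)
    orderedPairs-unique = pairsOf-unique (List.allFin n) (allFin-sorted n)

    others-unique : Unique others
    others-unique = UniqueP.filter⁺ (λ p → ¬? (p ≟ₚ (a , b))) orderedPairs-unique

    orderedPairs-↭ : orderedPairs n ↭ (a , b) ∷ others
    orderedPairs-↭ = uniqueSameMembers⇒↭ orderedPairs-unique (ab∉others ∷ others-unique) to from
      where
      ab∉others : All.All (λ p → ¬ (a , b) ≡ p) others
      ab∉others = All.tabulate λ m ab≡p → proj₂ (∈-filter⁻ (λ p → ¬? (p ≟ₚ (a , b))) {xs = orderedPairs n} m) (sym ab≡p)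
      to : ∀ {p} → p ∈ orderedPairs n → p ∈ (a , b) ∷ others
      to {p} m with p ≟ₚ (a , b)
      ... | yes p≡ab = here p≡ab
      ... | no p≢ab  = there (∈-filter⁺ (λ p → ¬? (p ≟ₚ (a , b))) m p≢ab)
      from : ∀ {p} → p ∈ (a , b) ∷ others → p ∈ orderedPairs n
      from (here refl) = ∈-orderedPairs a<b
      from (there m)   = proj₁ (∈-filter⁻ (λ p → ¬? (p ≟ₚ (a , b))) {xs = orderedPairs n} m)

    τₚ : Fin n × Fin n → Fin n × Fin n
    τₚ (x , y) = τ a b x , τ a b y

    τₚ-involutive : ∀ p → τₚ (τₚ p) ≡ p
    τₚ-involutive (x , y) = P.cong₂ _,_ (τ-involutive a b x) (τ-involutive a b y)

    τ-preserves-order : ∀ x y → x F.< y → (x , y) ≢ (a , b) → τ a b x F.< τ a b y × τₚ (x , y) ≢ (a , b)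
    τ-preserves-order x y x<y xy≢ab with transpositionCase a b x | transpositionCase a b y
    ... | atLeft refl | atLeft refl = ⊥-elim (FinP.<-irrefl refl x<y)
    ... | atLeft refl | atRight _ refl = ⊥-elim (xy≢ab refl)
    ... | atLeft refl | elsewhere y≢a y≢b rewrite τ-left a b | τ-other a b y y≢a y≢b =
          P.subst (N._< toℕ y) (sym consecutive) (NP.≤∧≢⇒< x<y (y≢b ∘ FinP.toℕ-injective ∘ sym ∘ trans consecutive))
          , (λ eq → FinP.<-irrefl (sym (cong proj₁ eq)) a<b)
    ... | atRight _ refl | atLeft refl = ⊥-elim (FinP.<-asym x<y a<b)
    ... | atRight _ refl | atRight _ refl = ⊥-elim (FinP.<-irrefl refl x<y)
    ... | atRight _ refl | elsewhere y≢a y≢b rewrite τ-right a b | τ-other a b y y≢a y≢b =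
          NP.<-trans a<b x<y , y≢b ∘ cong proj₂
    ... | elsewhere x≢a x≢b | atLeft refl rewrite τ-other a b x x≢a x≢b | τ-left a b =
          NP.<-trans x<y a<b , x≢a ∘ cong proj₁
    ... | elsewhere x≢a x≢b | atRight _ refl rewrite τ-other a b x x≢a x≢b | τ-right a b =
          NP.≤∧≢⇒< (NP.≤-pred (P.subst (toℕ x N.<_) consecutive x<y)) (x≢a ∘ FinP.toℕ-injective)
          , (λ eq → FinP.<-irrefl (cong proj₂ eq) a<b)
    ... | elsewhere x≢a x≢b | elsewhere y≢a y≢b rewrite τ-other a b x x≢a x≢b | τ-other a b y y≢a y≢b = x<y , xy≢ab

    τₚ-others : ∀ {p} → p ∈ others → τₚ p ∈ others
    τₚ-others {x , y} m with ∈-filter⁻ (λ p → ¬? (p ≟ₚ (a , b))) {xs = orderedPairs n} m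
    ... | m′ , xy≢ab with τ-preserves-order x y (∈-pairsOf⇒< (List.allFin n) (allFin-sorted n) m′) xy≢ab
    ...   | τx<τy , τxy≢ab = ∈-filter⁺ (λ p → ¬? (p ≟ₚ (a , b))) (∈-orderedPairs τx<τy) τxy≢ab

    others-↭ : List.map τₚ others ↭ others
    others-↭ = involution-↭ τₚ τₚ-involutive others others-unique τₚ-others

module VandermondePowers {c ℓ} (R : CommutativeRing c ℓ) where
  open CommutativeRing R using (_≈_; setoid)
  open import Relation.Binary.Reasoning.Setoid setoid
  open Poly R
  open PolyAlgebra R
  open Extraction R
  open Coefficients R
  open ExponentVectors
  open IndexLists
  open OrderedPairs

  pairs≡orderedPairs : ∀ n → pairs n ≡ orderedPairs n
  pairs≡orderedPairs n = fromSuffix [] (List.allFin n) P.refl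
    where
    fromSuffix : ∀ us vs → us ++ vs ≡ List.allFin n →
      List.concatMap (λ i → List.map (λ j → (i , j)) (List.filter (λ j → i F.<? j) (List.allFin n))) vs ≡ pairsOf vs
    fromSuffix us []       _  = P.refl
    fromSuffix us (v ∷ vs) eq = P.cong₂ _++_
      (P.cong (List.map (v ,_)) (P.trans (P.cong (List.filter (v F.<?_)) (P.sym eq))
                                  (sorted-suffix us v vs (P.subst (AllPairs F._<_) (P.sym eq) (allFin-sorted n)))))
      (fromSuffix (us ++ v ∷ []) vs (P.trans (LP.++-assoc us (v ∷ []) vs) eq))

  diffₚ : ∀ {n} → Fin n × Fin n → Pol n
  diffₚ (i , j) = diff i j

  vandPow-orderedPairs : ∀ n e → vandPow n e ≡ prodₚ (List.map (λ p → diffₚ p ^ₚ e) (orderedPairs n))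
  vandPow-orderedPairs n e = P.cong (λ ps → prodₚ (List.map (λ p → diffₚ p ^ₚ e) ps)) (pairs≡orderedPairs n)

  vandPow-suc : ∀ n e (L : Pol n) → vandPow n (suc e) *ₚ L ≋ vandermondeOf (List.allFin n) *ₚ (vandPow n e *ₚ L)
  vandPow-suc n e L = ≋-trans
    (*-congʳ≋ L (≋-trans (≋-reflexive (vandPow-orderedPairs n (suc e)))
                (≋-trans (prodₚ-map-* diffₚ (λ p → diffₚ p ^ₚ e) (orderedPairs n))
                         (*-congˡ≋ (vandermondeOf (List.allFin n)) (≋-reflexive (P.sym (vandPow-orderedPairs n e)))))))
    (*-assoc≋ (vandermondeOf (List.allFin n)) (vandPow n e) L)

  -- An odd power of Δ times a symmetric L is alternating in consecutive
  -- variables: Δ^(2k+1) L = (x_a - x_b) · (x_a - x_b)^(2k) · ∏_{other pairs} · L,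
  -- where the even power and L are invariant and (a b) permutes the other pairs.
  vandPow-odd-alternating : ∀ n k (L : Pol n) → Symmetric L → ∀ a b → Consecutive a b →
                            Alternating (vandPow n (suc (k N.+ k)) *ₚ L) a b
  vandPow-odd-alternating n k L symL a b consecutive = M , K≋ , M-invariant
    where
    open ConsecutiveSwap a b consecutive
    e = suc (k N.+ k)
    D = diff a b
    power : Fin n × Fin n → Pol n
    power p = diffₚ p ^ₚ e
    Rest = prodₚ (List.map power others)
    M = (D ^ₚ (k N.+ k)) *ₚ (Rest *ₚ L)
    K≋ : vandPow n e *ₚ L ≋ D *ₚ M
    K≋ = ≋-trans (*-congʳ≋ L (≋-trans (≋-reflexive (vandPow-orderedPairs n e)) (prodₚ-↭ (↭P.map⁺ power orderedPairs-↭))))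
         (≋-trans (*-assoc≋ (D *ₚ (D ^ₚ (k N.+ k))) Rest L) (*-assoc≋ D (D ^ₚ (k N.+ k)) (Rest *ₚ L)))
    D-antisym : swapVars a b D ≋ negate D
    D-antisym = ≋-trans (≋-reflexive (P.trans (swapVars-diff a b a b) (P.cong₂ diff (τ-left a b) (τ-right a b)))) (diff-antisym a b)
    Rest-invariant : swapVars a b Rest ≋ Rest
    Rest-invariant =
      ≋-trans (swapVars-prodₚ a b (List.map power others))
      (≋-trans (≋-reflexive (P.cong prodₚ (P.sym (LP.map-∘ others))))
      (≋-trans (prodₚ-map-cong (swapVars a b ∘ power) (power ∘ τₚ) others
                 (λ p → ≋-trans (swapVars-^ a b (diffₚ p) e) (^-cong≋ e (≋-reflexive (swapVars-diff a b (proj₁ p) (proj₂ p))))))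
      (≋-trans (≋-reflexive (P.cong prodₚ (LP.map-∘ others))) (prodₚ-↭ (↭P.map⁺ power others-↭)))))
    M-invariant : swapVars a b M ≋ M
    M-invariant = ≋-trans (swapVars-* a b (D ^ₚ (k N.+ k)) (Rest *ₚ L))
      (*-cong≋ (swapVars-even-^ a b D D-antisym k)
               (≋-trans (swapVars-* a b Rest L) (*-cong≋ Rest-invariant (Symmetric⇒swapVars-invariant L symL a b))))

  vandPow-extraction : ∀ n m′ (L : Pol n) → Symmetric L → ∀ c →
    coeff (vandPow n (2 N.* suc m′) *ₚ L) (replicate n c)
      ≈ (n N.!) · shiftedCoeff (vandPow n (2 N.* suc m′ N.∸ 1) *ₚ L) (replicate n c) (staircase (List.allFin n))
  vandPow-extraction n m′ L symL c = begin
    coeff (vandPow n (suc e) *ₚ L) t                         ≈⟨ coeff≈shiftedCoeff (vandPow n (suc e) *ₚ L) t ⟩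
    shiftedCoeff (vandPow n (suc e) *ₚ L) t 𝟎               ≈⟨ sameCoeffs (vandPow-suc n e L) t 𝟎 ⟩
    shiftedCoeff (vandermondeOf A *ₚ K) t 𝟎                 ≈⟨ extraction t (λ a b → swapExp-replicate a b c) A K (UniqueP.allFin⁺ n) alternating ⟩
    (List.length A N.!) · shiftedCoeff K t (staircase A)    ≡⟨ P.cong (λ l → (l N.!) · shiftedCoeff K t (staircase A)) (LP.length-tabulate {n = n} (λ i → i)) ⟩
    (n N.!) · shiftedCoeff K t (staircase A)                ∎
    where
    t = replicate n c
    A = List.allFin n
    e = 2 N.* suc m′ N.∸ 1
    K = vandPow n e *ₚ L
    e-odd : suc (m′ N.+ m′) ≡ e
    e-odd = P.trans (P.sym (NP.+-suc m′ m′)) (P.cong (λ x → m′ N.+ suc x) (P.sym (NP.+-identityʳ m′)))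
    alternating : Linked (Alternating K) A
    alternating = LinkedMap (λ {a} {b} consecutive → P.subst (λ e → Alternating (vandPow n e *ₚ L) a b) e-odd
                                                       (vandPow-odd-alternating n m′ L symL a b consecutive))
                            (allFin-consecutive n)

open import Data.Nat using (_≥_; _*_; _∸_; _!)
open import Data.Integer using (_+_; _-_; +_)

-- For k ≥ 1 the left side is [x^(k-1,…,k-1)] Δ^(2m) L, which vandPow-extraction
-- and shiftedCoeff≈coeffℤ turn into n! times the coefficient of Δ^(2m-1) L at
-- (k-1,…,k-1) - staircase; for k ≤ 0 the first exponent on both sides is
-- negative, so both coefficients are 0.
lemma2p1 : ∀ {c ℓ} (R : CommutativeRing c ℓ) (n m : ℕ) (k : ℤ) → n ≥ 1 → m ≥ 1 →
    let open CommutativeRing R using (_≈_)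
        open Poly R
    in (L : Pol n) → Symmetric L →
       coeffℤ (vandPow n (2 * m) *ₚ L) (replicate n (k - + 1))
         ≈ (n !) · coeffℤ (vandPow n (2 * m ∸ 1) *ₚ L) (tabulate (λ i → (k - + n) + + toℕ i))
lemma2p1 R n (suc m′) (+ suc c) _ _ L symL = begin
  coeffℤ (vandPow n (2 * suc m′) *ₚ L) (replicate n (+ c))  ≡⟨ coeffℤ-replicate (vandPow n (2 * suc m′) *ₚ L) c ⟩
  coeff (vandPow n (2 * suc m′) *ₚ L) (replicate n c)       ≈⟨ vandPow-extraction n m′ L symL c ⟩
  (n !) · shiftedCoeff K (replicate n c) (staircase (List.allFin n))
                                                           ≈⟨ ·-cong (n !) (shiftedCoeff≈coeffℤ K (replicate n c) (staircase (List.allFin n))) ⟩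
  (n !) · coeffℤ K (intDiff (replicate n c) (staircase (List.allFin n)))
                                                           ≡⟨ P.cong (λ v → (n !) · coeffℤ K v) (intDiff-staircase n c) ⟩
  (n !) · coeffℤ K (tabulate (λ i → (+ suc c - + n) + + toℕ i)) ∎
  where
  open CommutativeRing R using (setoid)
  open import Relation.Binary.Reasoning.Setoid setoid
  open Poly R
  open ExponentVectors
  open IndexLists
  open PolyAlgebra R
  open Extraction R
  open Coefficients R
  open VandermondePowers R
  K = vandPow n (2 * suc m′ ∸ 1) *ₚ L
lemma2p1 R (suc n′) (suc m′) (+ zero)   _ _ L symL = CommutativeRing.sym R (Extraction.·-zero R (suc n′ !))
lemma2p1 R (suc n′) (suc m′) -[1+ _ ]  _ _ L symL = CommutativeRing.sym R (Extraction.·-zero R (suc n′ !))
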